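{- Let $T$ be a $\Delta(1,2,2)$-free tournament and let $X\subseteq V(T)$. Then: (1) if $T[X]$ is isomorphic to $T_5$ or $P_7$, then $X$ is a homogeneous set of $T$; (2) if $T[X]$ is isomorphic to $P_7^-$, then the degree partition of $T[X]$ is a homogeneous pair of $T$; (3) substituting a basic tournament for a nice vertex of $T$, or applying a $P_7^-$-join to a bridge of $T$, results in a $\Delta(1,2,2)$-free tournament. Moreover, if $T$ contains a basic tournament, then $T$ can be constructed from a $\Delta(1,2,2)$-free tournament with fewer vertices by substituting a basic tournament for a nice vertex or by applying a $P_7^-$-join to a bridge.
   Context: Tournaments are finite; $uv\in E(T)$ means the edge is directed from $u$ to $v$; $T[X]$ is the induced subtournament, $T\setminus X=T[V(T)\setminus X]$; $T$ contains $S$ if some induced subtournament is isomorphic to $S$, otherwise $T$ is $S$-free. $X\Rightarrow Y$ means all edges between disjoint nonempty $X,Y$ go from $X$ to $Y$. $\Delta(1,2,2)$: vertices $x,y_1,y_2,z_1,z_2$ with $x\Rightarrow\{y_1,y_2\}\Rightarrow\{z_1,z_2\}\Rightarrow x$ and edges $y_1y_2,z_1z_2$. $T_5$: vertices $v_1,\dots,v_5$, $v_iv_j\in E$ iff $j-i\equiv1,2\pmod5$. $P_7$: $v_1,\dots,v_7$, $v_iv_j\in E$ iff $j-i\equiv1,2,4\pmod7$. $P_7^-$: $P_7$ minus a vertex. Basic tournaments: $T_5,P_7^-,P_7$. Degree partition of $P_7^-$: $(D_1,D_2)$, $D_1$ = vertices of out-degree $3$, $D_2$ = vertices of out-degree $2$.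 Homogeneous set: nonempty $X$ with $v\Rightarrow X$ or $X\Rightarrow v$ for each $v\notin X$. Homogeneous pair: disjoint nonempty $(A_1,A_2)$ with $A_1$ homogeneous in $T\setminus A_2$ and $A_2$ homogeneous in $T\setminus A_1$. Ordering $\sigma=(v_1,\dots,v_n)$; backedge graph $B_\sigma(T)$: undirected graph on $V(T)$ with edges $v_iv_j$ where $i>j$ and $v_iv_j\in E(T)$. Nice vertex $v$: no three distinct $x,y_1,y_2$ with both $\{v,x,y_1\}$, $\{v,x,y_2\}$ inducing cyclic triangles. Bridge: an edge $uv\in E(T)$ such that for some ordering $\sigma=(v_1,\dots,v_n)$ with $u=v_i$, $v=v_j$, $i>j$, $uv$ is an isolated edge of $B_\sigma(T)$ and the edges of $B_\sigma(T)$ between $\{v_s:s<i\}$ and $\{v_t:t>i\}$, and also between $\{v_s:s<j\}$ and $\{v_t:t>j\}$, form matchings. Substituting $S_2$ for $v\in V(S_1)$: replace $v$ by a copy of $S_2$, and for $x_1\ne v$, $x_2\in V(S_2)$ direct $x_1x_2$ iff $x_1v\in E(S_1)$. $P_7^-$-join to an edge $uv$ of $J$: replace $u,v$ by a copy $S$ of $P_7^-$ with degree partition $(D_1,D_2)$; each remaining vertex $w$ is joined to all of $D_2$ as it was to $u$ and to all of $D_1$ as it was to $v$; all other edges as in $J$ and $S$. -}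

module Defs where

open import Data.Nat using (ℕ; zero; suc; _+_; _∸_; _<_; _≡ᵇ_)
open import Data.Nat.DivMod using (_%_)
open import Data.Bool using (Bool; true; false; not; _∧_; _∨_; if_then_else_; T)
open import Data.Fin using (Fin; toℕ; inject₁; _>_; _≟_)
open import Data.Fin.Subset using (Subset; _∈_; _∉_; _∩_; ∣_∣; Nonempty)
open import Data.Fin.Permutation using (Permutation′; _⟨$⟩ʳ_)
open import Data.Vec using (tabulate; lookup)
open import Data.List using (List; []; _∷_)
open import Data.Bool.ListAction using (any)
open import Data.Product using (Σ; _×_; _,_; ∃; proj₁)
open import Data.Sum using (_⊎_; inj₁; inj₂)
open import Relation.Binary.PropositionalEquality using (_≡_; _≢_)
open import Relation.Nullary using (¬_)
open import Relation.Nullary.Decidable using (⌊_⌋)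
open import Function.Definitions using (Injective)
open import Function.Bundles using (_⤖_; Bijection)

-- Digraphs given by a Boolean adjacency function; "a u v ≡ true" means
-- the edge uv (directed from u to v) is present.

Adj : Set → Set
Adj V = V → V → Bool

Edge : {V : Set} → Adj V → V → V → Set
Edge a u v = a u v ≡ true

IsTournament : {V : Set} → Adj V → Set
IsTournament {V} a = (∀ v → a v v ≡ false) × (∀ (u v : V) → u ≢ v → a v u ≡ not (a u v))

Contains : {V : Set} {k : ℕ} → Adj V → Adj (Fin k) → Set
Contains {V} {k} a S =
  Σ (Fin k → V) λ f → Injective _≡_ _≡_ f × (∀ i j → a (f i) (f j) ≡ S i j)

Free : {V : Set} {k : ℕ} → Adj V → Adj (Fin k) → Set
Free a S = ¬ Contains a S

Iso : {V W : Set} → Adj V → Adj W → Set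
Iso {V} {W} a b = Σ (V ⤖ W) λ f → ∀ x y → b (Bijection.to f x) (Bijection.to f y) ≡ a x y

-- Specific tournaments (vertices v_1..v_k represented by Fin k, v_i ↦ i-1).

T₅ : Adj (Fin 5)
T₅ i j = (d ≡ᵇ 1) ∨ (d ≡ᵇ 2)
  where d = ((5 + toℕ j) ∸ toℕ i) % 5

P₇ : Adj (Fin 7)
P₇ i j = (d ≡ᵇ 1) ∨ (d ≡ᵇ 2) ∨ (d ≡ᵇ 4)
  where d = ((7 + toℕ j) ∸ toℕ i) % 7

-- P_7^- : P_7 minus a vertex (P_7 is vertex-transitive; we delete v_7).
P₇⁻ : Adj (Fin 6)
P₇⁻ i j = P₇ (inject₁ i) (inject₁ j)

-- Δ(1,2,2): x = 0, y₁ = 1, y₂ = 2, z₁ = 3, z₂ = 4.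
Δedges : List (ℕ × ℕ)
Δedges = (0 , 1) ∷ (0 , 2) ∷ (1 , 3) ∷ (1 , 4) ∷ (2 , 3) ∷ (2 , 4)
       ∷ (3 , 0) ∷ (4 , 0) ∷ (1 , 2) ∷ (3 , 4) ∷ []

Δ122 : Adj (Fin 5)
Δ122 i j = any (λ { (p , q) → (p ≡ᵇ toℕ i) ∧ (q ≡ᵇ toℕ j) }) Δedges

data Basic : Set where
  t5 p7⁻ p7 : Basic

bsize : Basic → ℕ
bsize t5 = 5
bsize p7⁻ = 6
bsize p7 = 7

badj : (b : Basic) → Adj (Fin (bsize b))
badj t5 = T₅
badj p7⁻ = P₇⁻
badj p7 = P₇

module _ {n : ℕ} (a : Adj (Fin n)) where

  InducedIso : {k : ℕ} → Subset n → Adj (Fin k) → Set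
  InducedIso {k} X S =
    Σ (Fin k → Fin n) λ f → Injective _≡_ _≡_ f
      × (∀ v → v ∈ X → ∃ λ i → f i ≡ v)
      × (∀ i → f i ∈ X)
      × (∀ i j → a (f i) (f j) ≡ S i j)

  Homog-at : Subset n → Fin n → Set
  Homog-at X v = (∀ x → x ∈ X → Edge a v x) ⊎ (∀ x → x ∈ X → Edge a x v)

  HomogeneousSet : Subset n → Set
  HomogeneousSet X = Nonempty X × (∀ v → v ∉ X → Homog-at X v)

  HomogeneousPair : Subset n → Subset n → Set
  HomogeneousPair A₁ A₂ =
    (∀ v → v ∈ A₁ → v ∉ A₂) × Nonempty A₁ × Nonempty A₂
    × (∀ v → v ∉ A₁ → v ∉ A₂ → Homog-at A₁ v)
    × (∀ v → v ∉ A₂ → v ∉ A₁ → Homog-at A₂ v)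

  outNbhd : Fin n → Subset n
  outNbhd v = tabulate (λ u → a v u)

  outdegIn : Subset n → Fin n → ℕ
  outdegIn X v = ∣ X ∩ outNbhd v ∣

  D₁ : Subset n → Subset n
  D₁ X = tabulate (λ v → lookup X v ∧ (outdegIn X v ≡ᵇ 3))

  D₂ : Subset n → Subset n
  D₂ X = tabulate (λ v → lookup X v ∧ (outdegIn X v ≡ᵇ 2))

  CyclicTriangle : Fin n → Fin n → Fin n → Set
  CyclicTriangle x y z = (Edge a x y × Edge a y z × Edge a z x)
                       ⊎ (Edge a x z × Edge a z y × Edge a y x)

  Nice : Fin n → Set
  Nice v = ¬ (Σ (Fin n) λ x → Σ (Fin n) λ y₁ → Σ (Fin n) λ y₂ →
                x ≢ y₁ × x ≢ y₂ × y₁ ≢ y₂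
              × CyclicTriangle v x y₁ × CyclicTriangle v x y₂)

  -- Backedge graph of the ordering σ, on positions: v_i = σ ⟨$⟩ʳ i.
  Back : Permutation′ n → Fin n → Fin n → Set
  Back σ i j = i > j × Edge a (σ ⟨$⟩ʳ i) (σ ⟨$⟩ʳ j)

  BEdge : Permutation′ n → Fin n → Fin n → Set
  BEdge σ i j = Back σ i j ⊎ Back σ j i

  CutMatching : Permutation′ n → Fin n → Set
  CutMatching σ i =
    (∀ s t t′ → s Data.Fin.< i → i Data.Fin.< t → i Data.Fin.< t′ →
       BEdge σ s t → BEdge σ s t′ → t ≡ t′)
    × (∀ s s′ t → s Data.Fin.< i → s′ Data.Fin.< i → i Data.Fin.< t →
       BEdge σ s t → BEdge σ s′ t → s ≡ s′)

  Bridge : Fin n → Fin n → Set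
  Bridge u v = Edge a u v × Σ (Permutation′ n) λ σ → Σ (Fin n) λ i → Σ (Fin n) λ j →
      σ ⟨$⟩ʳ i ≡ u × σ ⟨$⟩ʳ j ≡ v × i > j
    × (∀ k → BEdge σ i k → k ≡ j) × (∀ k → BEdge σ j k → k ≡ i)
    × CutMatching σ i × CutMatching σ j

Rest : (n : ℕ) → Fin n → Set
Rest n v = Σ (Fin n) λ w → T (not ⌊ w ≟ v ⌋)

Rest2 : (n : ℕ) → Fin n → Fin n → Set
Rest2 n u v = Σ (Fin n) λ w → T (not ⌊ w ≟ u ⌋ ∧ not ⌊ w ≟ v ⌋)

Subst : {n k : ℕ} → Adj (Fin n) → (v : Fin n) → Adj (Fin k) → Adj (Rest n v ⊎ Fin k)
Subst a v S (inj₁ (x , _)) (inj₁ (y , _)) = a x y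
Subst a v S (inj₁ (x , _)) (inj₂ s) = a x v
Subst a v S (inj₂ s) (inj₁ (y , _)) = a v y
Subst a v S (inj₂ s) (inj₂ t) = S s t

-- s lies in D₁ of the degree partition of P₇⁻ (out-degree 3); every other
-- vertex of P₇⁻ has out-degree 2, i.e. lies in D₂.
inD₁P₇⁻ : Fin 6 → Bool
inD₁P₇⁻ s = outdegIn P₇⁻ (tabulate (λ _ → true)) s ≡ᵇ 3

Join : {n : ℕ} → Adj (Fin n) → (u v : Fin n) → Adj (Rest2 n u v ⊎ Fin 6)
Join J u v (inj₁ (x , _)) (inj₁ (y , _)) = J x y
Join J u v (inj₁ (x , _)) (inj₂ s) = if inD₁P₇⁻ s then J x v else J x u
Join J u v (inj₂ s) (inj₁ (y , _)) = if inD₁P₇⁻ s then J v y else J u y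
Join J u v (inj₂ s) (inj₂ t) = P₇⁻ s t

-- Every assertion is reduced to finite configurations, which are checked by evaluating Boolean
-- searches.
--
-- (1), (2): an outside vertex w and a copy of a basic tournament S span a tournament on
-- |S| + 1 vertices that is determined by the edges from w to S.  Going through all 2^|S|
-- possibilities shows that in every Δ(1,2,2)-free one, w is homogeneous to S (for S = P₇⁻: to each
-- class of the degree partition).
--
-- (3): a vertex of a blow-up (a substitution, or a P₇⁻-join) is either a vertex of the inserted
-- tournament or an old vertex, and for the inserted part only its edges to the replaced vertices
-- matter.  Searching all such "shapes" of five vertices shows that a copy of Δ(1,2,2) in the
-- blow-up yields a copy in T or two cyclic triangles through a replaced vertex sharing an edge;
-- the latter is excluded by niceness, and for a bridge uv by the matching conditions at u and v.
--
-- Decomposition: a copy of T₅ or P₇ is a homogeneous set, so contracting it to one vertex gives a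
-- smaller Δ(1,2,2)-free tournament in which that vertex is nice.  For P₇⁻ only the degree
-- partition (D₁, D₂) is homogeneous: a vertex w with u → w → v (u ∈ D₂, v ∈ D₁) extends it to P₇;
-- otherwise contracting D₂ to u and D₁ to v and ordering the other vertices by their edges to u
-- and v turns uv into a bridge.
module Submission where

open import Defs

open import Data.Bool using (Bool; true; false; not; _∧_; _∨_; if_then_else_; T)
  renaming (_≟_ to _≟ᵇ_)
open import Data.Bool.ListAction using (all)
open import Data.Bool.Properties using (T-∧; T-∨; T-≡; T-not-≡; T-irrelevant; not-involutive; ∨-identityʳ)
open import Data.Empty using (⊥; ⊥-elim)
open import Data.Fin using (Fin; zero; suc; _≟_; splitAt; _↑ˡ_; combine; remQuot)
import Data.Fin as Fin
open import Data.Fin.Patterns using (0F; 1F; 2F; 3F; 4F; 5F)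
open import Data.Fin.Permutation using (Permutation′; _⟨$⟩ʳ_; _⟨$⟩ˡ_; inverseʳ)
  renaming (id to id-permutation)
open import Data.Fin.Properties
  using (suc-injective; injective⇒≤; <-cmp; <⇒≢; splitAt-↑ˡ; combine-remQuot; remQuot-combine; combine-monoˡ-<)
open import Data.Fin.Subset using (Subset; _∈_; _∉_; _∩_; ∣_∣)
open import Data.List using (List; []; _∷_; map; _++_; allFin)
open import Data.List.Membership.Propositional using () renaming (_∈_ to _∈ˡ_)
open import Data.List.Membership.Propositional.Properties using (∈-++⁺ˡ; ∈-++⁺ʳ; ∈-map⁺; ∈-allFin)
import Data.List.Relation.Unary.All as All
open import Data.List.Relation.Unary.All.Properties using (all⁺)
open import Data.List.Relation.Unary.Any using (here; there)
open import Data.Nat using (ℕ; zero; suc; _+_; _*_; _<_; _≤_; _≡ᵇ_; s≤s; z≤n)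
open import Data.Nat.Properties using (≤-antisym; ≮⇒≥; <-asym; <-trans)
open import Data.Product using (Σ; ∃; _×_; _,_; proj₁; proj₂)
open import Data.Sum using (_⊎_; inj₁; inj₂; [_,_])
open import Data.Unit using (tt)
open import Data.Vec using (Vec; []; _∷_; lookup; tabulate)
open import Data.Vec.Properties using (lookup∘tabulate; lookup-zipWith; []=⇒lookup; lookup⇒[]=)
open import Function using (_∘_)
open import Function.Bundles using (Equivalence; mk⤖)
open import Function.Definitions using (Injective)
open import Relation.Binary.Definitions using (tri<; tri≈; tri>)
open import Relation.Binary.PropositionalEquality hiding ([_])
open import Relation.Nullary using (¬_; yes; no)
open import Relation.Nullary.Decidable using (Dec; ⌊_⌋; toWitness; fromWitness; toWitnessFalse; fromWitnessFalse)

T-∧⁻ : ∀ x {y} → T (x ∧ y) → T x × T y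
T-∧⁻ x = Equivalence.to (T-∧ {x})

T-∧⁺ : ∀ x {y} → T x → T y → T (x ∧ y)
T-∧⁺ x p q = Equivalence.from (T-∧ {x}) (p , q)

T-∨⁻ : ∀ x {y} → T (x ∨ y) → T x ⊎ T y
T-∨⁻ x = Equivalence.to (T-∨ {x})

T-∨⁺ˡ : ∀ x {y} → T x → T (x ∨ y)
T-∨⁺ˡ x p = Equivalence.from (T-∨ {x}) (inj₁ p)

T-∨⁺ʳ : ∀ x {y} → T y → T (x ∨ y)
T-∨⁺ʳ x q = Equivalence.from (T-∨ {x}) (inj₂ q)

T⇒≡ : ∀ {x} → T x → x ≡ true
T⇒≡ = Equivalence.to T-≡

≡⇒T : ∀ {x} → x ≡ true → T x
≡⇒T = Equivalence.from T-≡

T-not⇒≡ : ∀ {x} → T (not x) → x ≡ false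
T-not⇒≡ = Equivalence.to T-not-≡

modus-ponensᵇ : ∀ x {y} → T x → T (not x ∨ y) → T y
modus-ponensᵇ true _ h = h

allᵇ : (N : ℕ) → (Fin N → Bool) → Bool
allᵇ zero    P = true
allᵇ (suc N) P = P zero ∧ allᵇ N (λ i → P (suc i))

anyᵇ : (N : ℕ) → (Fin N → Bool) → Bool
anyᵇ zero    P = false
anyᵇ (suc N) P = P zero ∨ anyᵇ N (λ i → P (suc i))

allᵇ-sound : ∀ N {P} → T (allᵇ N P) → ∀ i → T (P i)
allᵇ-sound (suc N) {P} h zero    = proj₁ (T-∧⁻ (P zero) h)
allᵇ-sound (suc N) {P} h (suc i) = allᵇ-sound N (proj₂ (T-∧⁻ (P zero) h)) i

anyᵇ-sound : ∀ N {P} → T (anyᵇ N P) → ∃ λ i → T (P i)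
anyᵇ-sound (suc N) {P} h with T-∨⁻ (P zero) h
... | inj₁ p = zero , p
... | inj₂ q with i , r ← anyᵇ-sound N q = suc i , r

anyᵇ-complete : ∀ N {P} i → T (P i) → T (anyᵇ N P)
anyᵇ-complete (suc N) {P} zero    p = T-∨⁺ˡ (P zero) p
anyᵇ-complete (suc N) {P} (suc i) p = T-∨⁺ʳ (P zero) (anyᵇ-complete N i p)

Σ-T-≡ : ∀ {N} {P : Fin N → Bool} {x y : Fin N} {px : T (P x)} {py : T (P y)} →
  x ≡ y → _≡_ {A = Σ (Fin N) (λ w → T (P w))} (x , px) (y , py)
Σ-T-≡ {x = x} {px = px} {py} refl = cong (x ,_) (T-irrelevant px py)

rest2⇒≢ : ∀ {N} {x u v : Fin N} → T (not ⌊ x ≟ u ⌋ ∧ not ⌊ x ≟ v ⌋) → x ≢ u × x ≢ v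
rest2⇒≢ {x = x} {u} h = toWitnessFalse (proj₁ x∉) , toWitnessFalse (proj₂ x∉)
  where x∉ = T-∧⁻ (not ⌊ x ≟ u ⌋) h

isTournamentᵇ : (k : ℕ) → Adj (Fin k) → Bool
isTournamentᵇ k S =
  allᵇ k (λ i → not (S i i)) ∧ allᵇ k (λ i → allᵇ k (λ j → ⌊ i ≟ j ⌋ ∨ ⌊ S j i ≟ᵇ not (S i j) ⌋))

isTournamentᵇ-sound : ∀ k S → T (isTournamentᵇ k S) → IsTournament S
isTournamentᵇ-sound k S h = (λ i → T-not⇒≡ (allᵇ-sound k (proj₁ checks) i)) , antisymmetric
  where
  checks = T-∧⁻ (allᵇ k (λ i → not (S i i))) h
  antisymmetric : ∀ i j → i ≢ j → S j i ≡ not (S i j)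
  antisymmetric i j i≢j with T-∨⁻ ⌊ i ≟ j ⌋ (allᵇ-sound k (allᵇ-sound k (proj₂ checks) i) j)
  ... | inj₁ i≡j = ⊥-elim (i≢j (toWitness i≡j))
  ... | inj₂ eq  = toWitness eq

basic-tournament : ∀ b → IsTournament (badj b)
basic-tournament t5  = isTournamentᵇ-sound 5 T₅ tt
basic-tournament p7⁻ = isTournamentᵇ-sound 6 P₇⁻ tt
basic-tournament p7  = isTournamentᵇ-sound 7 P₇ tt

Δ-tournament : IsTournament Δ122
Δ-tournament = isTournamentᵇ-sound 5 Δ122 tt

Homomorphism : ∀ {V W : Set} → Adj V → Adj W → (V → W) → Set
Homomorphism E a H = ∀ p q → Edge E p q → Edge a (H p) (H q)

IsCopy : ∀ {n k} → Adj (Fin n) → Adj (Fin k) → (Fin k → Fin n) → Set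
IsCopy a S f = ∀ i j → a (f i) (f j) ≡ S i j

copy⇒homomorphism : ∀ {n k} {a : Adj (Fin n)} {S : Adj (Fin k)} {f} → IsCopy a S f → Homomorphism S a f
copy⇒homomorphism copy i j e = trans (copy i j) e

record ΔImage {V : Set} (E : Adj V) : Set where
  constructor Δ-image
  field
    {x y₁ y₂ z₁ z₂} : V
    xy₁  : Edge E x y₁
    xy₂  : Edge E x y₂
    y₁y₂ : Edge E y₁ y₂
    y₁z₁ : Edge E y₁ z₁
    y₁z₂ : Edge E y₁ z₂
    y₂z₁ : Edge E y₂ z₁
    y₂z₂ : Edge E y₂ z₂
    z₁z₂ : Edge E z₁ z₂
    z₁x  : Edge E z₁ x
    z₂x  : Edge E z₂ x

ΔImage-map : ∀ {V W : Set} {E : Adj V} {a : Adj W} {H : V → W} → Homomorphism E a H → ΔImage E → ΔImage a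
ΔImage-map hom (Δ-image xy₁ xy₂ y₁y₂ y₁z₁ y₁z₂ y₂z₁ y₂z₂ z₁z₂ z₁x z₂x) =
  Δ-image (hom _ _ xy₁) (hom _ _ xy₂) (hom _ _ y₁y₂) (hom _ _ y₁z₁) (hom _ _ y₁z₂)
          (hom _ _ y₂z₁) (hom _ _ y₂z₂) (hom _ _ z₁z₂) (hom _ _ z₁x) (hom _ _ z₂x)

cyclic-map : ∀ {N n} {E : Adj (Fin N)} {a : Adj (Fin n)} {H : Fin N → Fin n} → Homomorphism E a H →
  ∀ {w x y} → CyclicTriangle E w x y → CyclicTriangle a (H w) (H x) (H y)
cyclic-map hom (inj₁ (wx , xy , yw)) = inj₁ (hom _ _ wx , hom _ _ xy , hom _ _ yw)
cyclic-map hom (inj₂ (wy , yx , xw)) = inj₂ (hom _ _ wy , hom _ _ yx , hom _ _ xw)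

-- Nice a v is, by definition, ¬ Σ x y₁ y₂ (TwoTriangles a v x y₁ y₂).
TwoTriangles : ∀ {n} → Adj (Fin n) → Fin n → Fin n → Fin n → Fin n → Set
TwoTriangles a v x y₁ y₂ =
  x ≢ y₁ × x ≢ y₂ × y₁ ≢ y₂ × CyclicTriangle a v x y₁ × CyclicTriangle a v x y₂

opaque
  hasΔᵇ : (N : ℕ) → Adj (Fin N) → Bool
  hasΔᵇ N E =
    anyᵇ N λ x → anyᵇ N λ y₁ → E x y₁ ∧ (anyᵇ N λ y₂ → E x y₂ ∧ (E y₁ y₂ ∧
    (anyᵇ N λ z₁ → E y₁ z₁ ∧ (E y₂ z₁ ∧ (E z₁ x ∧
    (anyᵇ N λ z₂ → E y₁ z₂ ∧ (E y₂ z₂ ∧ (E z₁ z₂ ∧ E z₂ x))))))))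

  hasΔᵇ-sound : ∀ N E → T (hasΔᵇ N E) → ΔImage E
  hasΔᵇ-sound N E h
    with x , h ← anyᵇ-sound N h
    with y₁ , h ← anyᵇ-sound N h
    with xy₁ , h ← T-∧⁻ (E x y₁) h
    with y₂ , h ← anyᵇ-sound N h
    with xy₂ , h ← T-∧⁻ (E x y₂) h
    with y₁y₂ , h ← T-∧⁻ (E y₁ y₂) h
    with z₁ , h ← anyᵇ-sound N h
    with y₁z₁ , h ← T-∧⁻ (E y₁ z₁) h
    with y₂z₁ , h ← T-∧⁻ (E y₂ z₁) h
    with z₁x , h ← T-∧⁻ (E z₁ x) h
    with z₂ , h ← anyᵇ-sound N h
    with y₁z₂ , h ← T-∧⁻ (E y₁ z₂) h
    with y₂z₂ , h ← T-∧⁻ (E y₂ z₂) h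
    with z₁z₂ , z₂x ← T-∧⁻ (E z₁ z₂) h
    = Δ-image (T⇒≡ xy₁) (T⇒≡ xy₂) (T⇒≡ y₁y₂) (T⇒≡ y₁z₁) (T⇒≡ y₁z₂)
              (T⇒≡ y₂z₁) (T⇒≡ y₂z₂) (T⇒≡ z₁z₂) (T⇒≡ z₁x) (T⇒≡ z₂x)

cyclicᵇ : ∀ {N} → Adj (Fin N) → Fin N → Fin N → Fin N → Bool
cyclicᵇ E w x y = (E w x ∧ (E x y ∧ E y w)) ∨ (E w y ∧ (E y x ∧ E x w))

cyclicᵇ-sound : ∀ {N} (E : Adj (Fin N)) w x y → T (cyclicᵇ E w x y) → CyclicTriangle E w x y
cyclicᵇ-sound E w x y h with T-∨⁻ (E w x ∧ (E x y ∧ E y w)) h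
... | inj₁ h with wx , h ← T-∧⁻ (E w x) h with xy , yw ← T-∧⁻ (E x y) h
  = inj₁ (T⇒≡ wx , T⇒≡ xy , T⇒≡ yw)
... | inj₂ h with wy , h ← T-∧⁻ (E w y) h with yx , xw ← T-∧⁻ (E y x) h
  = inj₂ (T⇒≡ wy , T⇒≡ yx , T⇒≡ xw)

opaque
  twoTrianglesᵇ : ∀ N → (Fin N → Bool) → Adj (Fin N) → Fin N → Bool
  twoTrianglesᵇ N cand E w =
    anyᵇ N λ x → cand x ∧ anyᵇ N λ y₁ → cand y₁ ∧ (cyclicᵇ E w x y₁ ∧
    anyᵇ N λ y₂ → cand y₂ ∧ (E y₁ y₂ ∧ cyclicᵇ E w x y₂))

  twoTrianglesᵇ-sound : ∀ N cand (E : Adj (Fin N)) w → T (twoTrianglesᵇ N cand E w) →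
    Σ (Fin N) λ x → Σ (Fin N) λ y₁ → Σ (Fin N) λ y₂ → (T (cand x) × T (cand y₁) × T (cand y₂)) ×
      Edge E y₁ y₂ × CyclicTriangle E w x y₁ × CyclicTriangle E w x y₂
  twoTrianglesᵇ-sound N cand E w h
    with x , h ← anyᵇ-sound N h
    with cx , h ← T-∧⁻ (cand x) h
    with y₁ , h ← anyᵇ-sound N h
    with cy₁ , h ← T-∧⁻ (cand y₁) h
    with c₁ , h ← T-∧⁻ (cyclicᵇ E w x y₁) h
    with y₂ , h ← anyᵇ-sound N h
    with cy₂ , h ← T-∧⁻ (cand y₂) h
    with y₁y₂ , c₂ ← T-∧⁻ (E y₁ y₂) h
    = x , y₁ , y₂ , (cx , cy₁ , cy₂) , T⇒≡ y₁y₂ , cyclicᵇ-sound E w _ _ c₁ , cyclicᵇ-sound E w _ _ c₂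

module Tournament {n : ℕ} (a : Adj (Fin n)) (tour : IsTournament a) where

  irreflexive : ∀ x → a x x ≡ false
  irreflexive = proj₁ tour

  reverse : ∀ {x y} → x ≢ y → a y x ≡ not (a x y)
  reverse = proj₂ tour _ _

  edge⇒≢ : ∀ {x y} → Edge a x y → x ≢ y
  edge⇒≢ {x} xy refl with () ← trans (sym xy) (irreflexive x)

  edge⇒¬reverse : ∀ {x y} → Edge a x y → a y x ≡ false
  edge⇒¬reverse xy = trans (reverse (edge⇒≢ xy)) (cong not xy)

  ¬edge⇒reverse : ∀ {x y} → x ≢ y → a x y ≡ false → Edge a y x
  ¬edge⇒reverse x≢y xy = trans (reverse x≢y) (cong not xy)

  edge-asym : ∀ {x y} → Edge a x y → Edge a y x → ⊥
  edge-asym xy yx with () ← trans (sym (edge⇒¬reverse xy)) yx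

  edge-or-reverse : ∀ {x y} → x ≢ y → Edge a x y ⊎ Edge a y x
  edge-or-reverse {x} {y} x≢y = orient (a x y) refl
    where
    orient : ∀ b → a x y ≡ b → Edge a x y ⊎ Edge a y x
    orient true  xy = inj₁ xy
    orient false xy = inj₂ (¬edge⇒reverse x≢y xy)

  cyclic⇒≢ : ∀ {w x y} → CyclicTriangle a w x y → w ≢ x × w ≢ y × x ≢ y
  cyclic⇒≢ (inj₁ (wx , xy , yw)) = edge⇒≢ wx , (λ w≡y → edge⇒≢ yw (sym w≡y)) , edge⇒≢ xy
  cyclic⇒≢ (inj₂ (wy , yx , xw)) = (λ w≡x → edge⇒≢ xw (sym w≡x)) , edge⇒≢ wy , (λ x≡y → edge⇒≢ yx (sym x≡y))

  two-triangles-orientation : ∀ {w x y₁ y₂} → TwoTriangles a w x y₁ y₂ →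
    (Edge a w x × Edge a x y₁ × Edge a x y₂ × Edge a y₁ w × Edge a y₂ w)
    ⊎ (Edge a x w × Edge a y₁ x × Edge a y₂ x × Edge a w y₁ × Edge a w y₂)
  two-triangles-orientation (_ , _ , _ , inj₁ (wx , xy₁ , y₁w) , inj₁ (_ , xy₂ , y₂w)) = inj₁ (wx , xy₁ , xy₂ , y₁w , y₂w)
  two-triangles-orientation (_ , _ , _ , inj₂ (wy₁ , y₁x , xw) , inj₂ (wy₂ , y₂x , _)) = inj₂ (xw , y₁x , y₂x , wy₁ , wy₂)
  two-triangles-orientation (_ , _ , _ , inj₁ (wx , _) , inj₂ (_ , _ , xw)) = ⊥-elim (edge-asym wx xw)
  two-triangles-orientation (_ , _ , _ , inj₂ (_ , _ , xw) , inj₁ (wx , _)) = ⊥-elim (edge-asym wx xw)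

  homomorphism⇒copy : ∀ {k} {S : Adj (Fin k)} → IsTournament S → ∀ g → Homomorphism S a g → IsCopy a S g
  homomorphism⇒copy {S = S} Stour g hom i j with i ≟ j
  ... | yes refl = trans (irreflexive (g i)) (sym (proj₁ Stour i))
  ... | no i≢j with S i j in ij
  ...   | true  = hom i j ij
  ...   | false = edge⇒¬reverse (hom j i (trans (proj₂ Stour i j i≢j) (cong not ij)))

  copy⇒injective : ∀ {k} {S : Adj (Fin k)} → IsTournament S → ∀ g → IsCopy a S g → Injective _≡_ _≡_ g
  copy⇒injective {S = S} Stour g copy {i} {j} gi≡gj with i ≟ j
  ... | yes i≡j = i≡j
  ... | no i≢j with S i j in ij
  ...   | true  = ⊥-elim (edge⇒≢ (trans (copy i j) ij) gi≡gj)
  ...   | false = ⊥-elim (edge⇒≢ (trans (copy j i) (trans (proj₂ Stour i j i≢j) (cong not ij))) (sym gi≡gj))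

  Δ-copy : ΔImage a → Contains a Δ122
  Δ-copy (Δ-image {x} {y₁} {y₂} {z₁} {z₂} xy₁ xy₂ y₁y₂ y₁z₁ y₁z₂ y₂z₁ y₂z₂ z₁z₂ z₁x z₂x) =
    g , copy⇒injective Δ-tournament g copy , copy
    where
    g : Fin 5 → Fin n
    g 0F = x
    g 1F = y₁
    g 2F = y₂
    g 3F = z₁
    g 4F = z₂
    hom : Homomorphism Δ122 a g
    hom 0F 1F _ = xy₁
    hom 0F 2F _ = xy₂
    hom 1F 2F _ = y₁y₂
    hom 1F 3F _ = y₁z₁
    hom 1F 4F _ = y₁z₂
    hom 2F 3F _ = y₂z₁
    hom 2F 4F _ = y₂z₂
    hom 3F 4F _ = z₁z₂
    hom 3F 0F _ = z₁x
    hom 4F 0F _ = z₂x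
    hom 0F 0F ()
    hom 0F 3F ()
    hom 0F 4F ()
    hom 1F 0F ()
    hom 1F 1F ()
    hom 2F 0F ()
    hom 2F 1F ()
    hom 2F 2F ()
    hom 3F 1F ()
    hom 3F 2F ()
    hom 3F 3F ()
    hom 4F 1F ()
    hom 4F 2F ()
    hom 4F 3F ()
    hom 4F 4F ()
    copy : IsCopy a Δ122 g
    copy = homomorphism⇒copy Δ-tournament g hom

  Δ-copy-any-orientation : ∀ {x y₁ y₂ z₁ z₂} → y₁ ≢ y₂ → z₁ ≢ z₂ →
    Edge a x y₁ → Edge a x y₂ → Edge a y₁ z₁ → Edge a y₁ z₂ → Edge a y₂ z₁ → Edge a y₂ z₂ →
    Edge a z₁ x → Edge a z₂ x → Contains a Δ122
  Δ-copy-any-orientation y₁≢y₂ z₁≢z₂ xy₁ xy₂ y₁z₁ y₁z₂ y₂z₁ y₂z₂ z₁x z₂x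
    with edge-or-reverse y₁≢y₂ | edge-or-reverse z₁≢z₂
  ... | inj₁ y₁y₂ | inj₁ z₁z₂ = Δ-copy (Δ-image xy₁ xy₂ y₁y₂ y₁z₁ y₁z₂ y₂z₁ y₂z₂ z₁z₂ z₁x z₂x)
  ... | inj₁ y₁y₂ | inj₂ z₂z₁ = Δ-copy (Δ-image xy₁ xy₂ y₁y₂ y₁z₂ y₁z₁ y₂z₂ y₂z₁ z₂z₁ z₂x z₁x)
  ... | inj₂ y₂y₁ | inj₁ z₁z₂ = Δ-copy (Δ-image xy₂ xy₁ y₂y₁ y₂z₁ y₂z₂ y₁z₁ y₁z₂ z₁z₂ z₁x z₂x)
  ... | inj₂ y₂y₁ | inj₂ z₂z₁ = Δ-copy (Δ-image xy₂ xy₁ y₂y₁ y₂z₂ y₂z₁ y₁z₂ y₁z₁ z₂z₁ z₂x z₁x)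

  hasΔᵇ-transfer : ∀ {N} {E : Adj (Fin N)} {H : Fin N → Fin n} → Homomorphism E a H →
    T (hasΔᵇ N E) → Contains a Δ122
  hasΔᵇ-transfer {N} {E} hom h = Δ-copy (ΔImage-map hom (hasΔᵇ-sound N E h))

  twoTrianglesᵇ-transfer : ∀ {N cand} {E : Adj (Fin N)} {H : Fin N → Fin n} →
    Homomorphism E a H → ∀ w → T (twoTrianglesᵇ N cand E w) →
    Σ (Fin N) λ x → Σ (Fin N) λ y₁ → Σ (Fin N) λ y₂ → (T (cand x) × T (cand y₁) × T (cand y₂)) ×
      TwoTriangles a (H w) (H x) (H y₁) (H y₂)
  twoTrianglesᵇ-transfer {N} {cand} {E} {H} hom w h
    with x , y₁ , y₂ , cs , y₁y₂ , c₁ , c₂ ← twoTrianglesᵇ-sound N cand E w h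
    = x , y₁ , y₂ , cs , proj₂ (proj₂ (cyclic⇒≢ t₁)) , proj₂ (proj₂ (cyclic⇒≢ t₂)) , edge⇒≢ (hom _ _ y₁y₂) , t₁ , t₂
    where
    t₁ = cyclic-map {a = a} {H = H} hom c₁
    t₂ = cyclic-map {a = a} {H = H} hom c₂

-- One-vertex extensions of a copy

allPatternsᵇ : (k : ℕ) → (Vec Bool k → Bool) → Bool
allPatternsᵇ zero    Q = Q []
allPatternsᵇ (suc k) Q = allPatternsᵇ k (λ p → Q (true ∷ p)) ∧ allPatternsᵇ k (λ p → Q (false ∷ p))

allPatternsᵇ-sound : ∀ k Q → T (allPatternsᵇ k Q) → ∀ p → T (Q p)
allPatternsᵇ-sound zero    Q h []          = h
allPatternsᵇ-sound (suc k) Q h (true ∷ p)  =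
  allPatternsᵇ-sound k _ (proj₁ (T-∧⁻ (allPatternsᵇ k (λ p → Q (true ∷ p))) h)) p
allPatternsᵇ-sound (suc k) Q h (false ∷ p) =
  allPatternsᵇ-sound k _ (proj₂ (T-∧⁻ (allPatternsᵇ k (λ p → Q (true ∷ p))) h)) p

extend : ∀ {k} → Adj (Fin k) → Vec Bool k → Adj (Fin (suc k))
extend S p zero    zero    = false
extend S p zero    (suc j) = lookup p j
extend S p (suc i) zero    = not (lookup p i)
extend S p (suc i) (suc j) = S i j

_◂_ : ∀ {n k} → Fin n → (Fin k → Fin n) → Fin (suc k) → Fin n
(w ◂ f) zero    = w
(w ◂ f) (suc i) = f i

extension-copy : ∀ {n k} {a : Adj (Fin n)} → IsTournament a → ∀ {S : Adj (Fin k)} {f p w} →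
  IsCopy a S f → (∀ i → w ≢ f i) → (∀ i → a w (f i) ≡ lookup p i) → IsCopy a (extend S p) (w ◂ f)
extension-copy tour copy outside row zero    zero    = proj₁ tour _
extension-copy tour copy outside row zero    (suc j) = row j
extension-copy tour copy outside row (suc i) zero    = trans (proj₂ tour _ _ (outside i)) (cong not (row i))
extension-copy tour copy outside row (suc i) (suc j) = copy i j

Δ-free-extensionsᵇ : ∀ {k} → Adj (Fin k) → (Vec Bool k → Bool) → Bool
Δ-free-extensionsᵇ {k} S Q = allPatternsᵇ k (λ p → Q p ∨ hasΔᵇ (suc k) (extend S p))

uniformᵇ : ∀ {k} → (Fin k → Bool) → Vec Bool k → Bool
uniformᵇ {k} C p = allᵇ k (λ i → not (C i) ∨ lookup p i) ∨ allᵇ k (λ i → not (C i) ∨ not (lookup p i))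

Homog-on : ∀ {n k} → Adj (Fin n) → (Fin k → Fin n) → (Fin k → Bool) → Fin n → Set
Homog-on a f C w = (∀ i → T (C i) → Edge a w (f i)) ⊎ (∀ i → T (C i) → Edge a (f i) w)

module OutsideVertex {n : ℕ} (a : Adj (Fin n)) (tour : IsTournament a) (free : Free a Δ122)
  {k : ℕ} {S : Adj (Fin k)} {f : Fin k → Fin n} (copy : IsCopy a S f)
  {w : Fin n} (outside : ∀ i → w ≢ f i) where
  open Tournament a tour

  pattern-of : Vec Bool k
  pattern-of = tabulate (λ i → a w (f i))

  pattern-satisfies : ∀ {Q} → T (Δ-free-extensionsᵇ S Q) → T (Q pattern-of)
  pattern-satisfies {Q} chk
    with T-∨⁻ (Q pattern-of) (allPatternsᵇ-sound k (λ p → Q p ∨ hasΔᵇ (suc k) (extend S p)) chk pattern-of)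
  ... | inj₁ q = q
  ... | inj₂ Δ = ⊥-elim (free (hasΔᵇ-transfer (copy⇒homomorphism {a = a} {f = w ◂ f} extended) Δ))
    where
    extended : IsCopy a (extend S pattern-of) (w ◂ f)
    extended = extension-copy tour copy outside (λ i → sym (lookup∘tabulate _ i))

  uniformᵇ-sound : ∀ C → T (uniformᵇ C pattern-of) → Homog-on a f C w
  uniformᵇ-sound C h with T-∨⁻ (allᵇ k (λ i → not (C i) ∨ lookup pattern-of i)) h
  ... | inj₁ h = inj₁ λ i c →
    trans (sym (lookup∘tabulate _ i)) (T⇒≡ (modus-ponensᵇ (C i) c (allᵇ-sound k h i)))
  ... | inj₂ h = inj₂ λ i c → ¬edge⇒reverse (outside i)
    (trans (sym (lookup∘tabulate _ i)) (T-not⇒≡ (modus-ponensᵇ (C i) c (allᵇ-sound k h i))))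

opaque
  unfolding hasΔᵇ

  T₅-extensions : T (Δ-free-extensionsᵇ T₅ (uniformᵇ (λ _ → true)))
  T₅-extensions = tt

  P₇-extensions : T (Δ-free-extensionsᵇ P₇ (uniformᵇ (λ _ → true)))
  P₇-extensions = tt

  P₇⁻-extensions : T (Δ-free-extensionsᵇ P₇⁻ (λ p → uniformᵇ inD₁P₇⁻ p ∧ uniformᵇ (not ∘ inD₁P₇⁻) p))
  P₇⁻-extensions = tt

module _ {n : ℕ} {a : Adj (Fin n)} (tour : IsTournament a) (free : Free a Δ122) where

  copy-homogeneous : ∀ {k} {S : Adj (Fin k)} {f} → T (Δ-free-extensionsᵇ S (uniformᵇ (λ _ → true))) →
    IsCopy a S f → ∀ w → (∀ i → w ≢ f i) → Homog-on a f (λ _ → true) w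
  copy-homogeneous chk copy w outside = uniformᵇ-sound _ (pattern-satisfies {Q = uniformᵇ (λ _ → true)} chk)
    where open OutsideVertex a tour free copy outside

  P₇⁻-copy-classes : ∀ {f} → IsCopy a P₇⁻ f → ∀ w → (∀ i → w ≢ f i) →
    Homog-on a f inD₁P₇⁻ w × Homog-on a f (not ∘ inD₁P₇⁻) w
  P₇⁻-copy-classes copy w outside =
    uniformᵇ-sound _ (proj₁ (T-∧⁻ (uniformᵇ inD₁P₇⁻ pattern-of) checked)) ,
    uniformᵇ-sound _ (proj₂ (T-∧⁻ (uniformᵇ inD₁P₇⁻ pattern-of) checked))
    where
    open OutsideVertex a tour free copy outside
    checked = pattern-satisfies {Q = λ p → uniformᵇ inD₁P₇⁻ p ∧ uniformᵇ (not ∘ inD₁P₇⁻) p} P₇⁻-extensions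

module HomogeneousCopy {n : ℕ} (a : Adj (Fin n)) (tour : IsTournament a)
  {k : ℕ} {f : Fin k → Fin n} (C : Fin k → Bool) {c : Fin k} (c∈C : T (C c))
  (homogeneous : ∀ w → (∀ i → w ≢ f i) → Homog-on a f C w) where
  open Tournament a tour

  from-class : ∀ {w} → (∀ i → w ≢ f i) → Edge a (f c) w → ∀ i → T (C i) → Edge a (f i) w
  from-class {w} w∉ fc→w with homogeneous w w∉
  ... | inj₁ w⇒C = ⊥-elim (edge-asym fc→w (w⇒C c c∈C))
  ... | inj₂ C⇒w = C⇒w

  into-class : ∀ {w} → (∀ i → w ≢ f i) → Edge a w (f c) → ∀ i → T (C i) → Edge a w (f i)
  into-class {w} w∉ w→fc with homogeneous w w∉
  ... | inj₁ w⇒C = w⇒C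
  ... | inj₂ C⇒w = ⊥-elim (edge-asym w→fc (C⇒w c c∈C))

  to-class : ∀ {w} → (∀ i → w ≢ f i) → ∀ i → T (C i) → a w (f i) ≡ a w (f c)
  to-class {w} w∉ i i∈C with homogeneous w w∉
  ... | inj₁ w⇒C = trans (w⇒C i i∈C) (sym (w⇒C c c∈C))
  ... | inj₂ C⇒w = trans (edge⇒¬reverse (C⇒w i i∈C)) (sym (edge⇒¬reverse (C⇒w c c∈C)))

  of-class : ∀ {w} → (∀ i → w ≢ f i) → ∀ i → T (C i) → a (f i) w ≡ a (f c) w
  of-class {w} w∉ i i∈C with homogeneous w w∉
  ... | inj₁ w⇒C = trans (edge⇒¬reverse (w⇒C i i∈C)) (sym (edge⇒¬reverse (w⇒C c c∈C)))
  ... | inj₂ C⇒w = trans (C⇒w i i∈C) (sym (C⇒w c c∈C))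

count : (n : ℕ) → (Fin n → Bool) → ℕ
count zero    P = 0
count (suc n) P = if P zero then suc (count n (P ∘ suc)) else count n (P ∘ suc)

count-cong : ∀ n {P Q : Fin n → Bool} → (∀ i → P i ≡ Q i) → count n P ≡ count n Q
count-cong zero    eq = refl
count-cong (suc n) {P} {Q} eq rewrite eq zero = cong (λ c → if Q zero then suc c else c) (count-cong n (eq ∘ suc))

∣p∣≡count : ∀ {n} (p : Subset n) → ∣ p ∣ ≡ count n (lookup p)
∣p∣≡count []          = refl
∣p∣≡count (true ∷ p)  = cong suc (∣p∣≡count p)
∣p∣≡count (false ∷ p) = ∣p∣≡count p

enumerate : ∀ n (P : Fin n → Bool) → Fin (count n P) → Fin n
enumerate (suc n) P i with P zero
enumerate (suc n) P zero    | true  = zero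
enumerate (suc n) P (suc i) | true  = suc (enumerate n (P ∘ suc) i)
enumerate (suc n) P i       | false = suc (enumerate n (P ∘ suc) i)

enumerate-member : ∀ n (P : Fin n → Bool) i → T (P (enumerate n P i))
enumerate-member (suc n) P i with P zero in eq
enumerate-member (suc n) P zero    | true  = ≡⇒T eq
enumerate-member (suc n) P (suc i) | true  = enumerate-member n (P ∘ suc) i
enumerate-member (suc n) P i       | false = enumerate-member n (P ∘ suc) i

enumerate-injective : ∀ n (P : Fin n → Bool) → Injective _≡_ _≡_ (enumerate n P)
enumerate-injective (suc n) P {i} {j} eq with P zero
enumerate-injective (suc n) P {zero}  {zero}  eq | true  = refl
enumerate-injective (suc n) P {suc i} {suc j} eq | true  = cong suc (enumerate-injective n (P ∘ suc) (suc-injective eq))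
enumerate-injective (suc n) P {i}     {j}     eq | false = enumerate-injective n (P ∘ suc) (suc-injective eq)

enumerate-surjective : ∀ n (P : Fin n → Bool) w → T (P w) → ∃ λ i → enumerate n P i ≡ w
enumerate-surjective (suc n) P w h with P zero in eq
enumerate-surjective (suc n) P zero    h | true  = zero , refl
enumerate-surjective (suc n) P (suc w) h | true
  with i , e ← enumerate-surjective n (P ∘ suc) w h = suc i , cong suc e
enumerate-surjective (suc n) P zero    h | false = ⊥-elim (subst T eq h)
enumerate-surjective (suc n) P (suc w) h | false
  with i , e ← enumerate-surjective n (P ∘ suc) w h = i , cong suc e

enumerate-monotone : ∀ n (P : Fin n → Bool) {i j} → i Fin.< j → enumerate n P i Fin.< enumerate n P j
enumerate-monotone (suc n) P {i} {j} i<j with P zero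
enumerate-monotone (suc n) P {zero}  {suc j} _         | true  = s≤s z≤n
enumerate-monotone (suc n) P {suc i} {suc j} (s≤s i<j) | true  = s≤s (enumerate-monotone n (P ∘ suc) i<j)
enumerate-monotone (suc n) P {i}     {j}     i<j       | false = s≤s (enumerate-monotone n (P ∘ suc) i<j)

count-≤ : ∀ {n k} {P : Fin n → Bool} {Q : Fin k → Bool} (g : ∀ w → T (P w) → Fin k) →
  (∀ w p → T (Q (g w p))) → (∀ {w w′} p p′ → g w p ≡ g w′ p′ → w ≡ w′) → count n P ≤ count k Q
count-≤ {n} {k} {P} {Q} g maps-to injective = injective⇒≤ {f = h} h-injective
  where
  index : ∀ i → ∃ λ j → enumerate k Q j ≡ g (enumerate n P i) (enumerate-member n P i)
  index i = enumerate-surjective k Q _ (maps-to _ (enumerate-member n P i))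
  h : Fin (count n P) → Fin (count k Q)
  h i = proj₁ (index i)
  h-injective : Injective _≡_ _≡_ h
  h-injective {i} {j} eq = enumerate-injective n P (injective _ _
    (trans (sym (proj₂ (index i))) (trans (cong (enumerate k Q) eq) (proj₂ (index j)))))

count-image : ∀ {n k} (P : Fin n → Bool) (f : Fin k → Fin n) → Injective _≡_ _≡_ f →
  (∀ w → T (P w) → ∃ λ t → f t ≡ w) → count n P ≡ count k (P ∘ f)
count-image P f f-injective in-image = ≤-antisym
  (count-≤ (λ w p → proj₁ (in-image w p)) (λ w p → subst (T ∘ P) (sym (proj₂ (in-image w p))) p)
    (λ {w} {w′} p p′ eq → trans (sym (proj₂ (in-image w p))) (trans (cong f eq) (proj₂ (in-image w′ p′)))))
  (count-≤ (λ t _ → f t) (λ _ p → p) (λ _ _ → f-injective))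

-- Homogeneous sets and the degree partition of P₇⁻

P₇⁻-degree₃ : ∀ s → (count 6 (P₇⁻ s) ≡ᵇ 3) ≡ inD₁P₇⁻ s
P₇⁻-degree₃ 0F = refl
P₇⁻-degree₃ 1F = refl
P₇⁻-degree₃ 2F = refl
P₇⁻-degree₃ 3F = refl
P₇⁻-degree₃ 4F = refl
P₇⁻-degree₃ 5F = refl

P₇⁻-degree₂ : ∀ s → (count 6 (P₇⁻ s) ≡ᵇ 2) ≡ not (inD₁P₇⁻ s)
P₇⁻-degree₂ 0F = refl
P₇⁻-degree₂ 1F = refl
P₇⁻-degree₂ 2F = refl
P₇⁻-degree₂ 3F = refl
P₇⁻-degree₂ 4F = refl
P₇⁻-degree₂ 5F = refl

module InducedCopy {n : ℕ} (a : Adj (Fin n)) {k : ℕ} {X : Subset n} {S : Adj (Fin k)}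
  (induced : InducedIso a X S) where

  f : Fin k → Fin n
  f = proj₁ induced

  f-injective : Injective _≡_ _≡_ f
  f-injective = proj₁ (proj₂ induced)

  onto-X : ∀ v → v ∈ X → ∃ λ i → f i ≡ v
  onto-X = proj₁ (proj₂ (proj₂ induced))

  in-X : ∀ i → f i ∈ X
  in-X = proj₁ (proj₂ (proj₂ (proj₂ induced)))

  copy : IsCopy a S f
  copy = proj₂ (proj₂ (proj₂ (proj₂ induced)))

  outside-X : ∀ {w} → w ∉ X → ∀ i → w ≢ f i
  outside-X w∉X i refl = w∉X (in-X i)

  homog-on⇒homog-at : ∀ {C D w} → (∀ x → x ∈ D → ∃ λ i → f i ≡ x × T (C i)) →
    Homog-on a f C w → Homog-at a D w
  homog-on⇒homog-at from-D (inj₁ w⇒C) = inj₁ λ x x∈D → let i , fi≡x , c = from-D x x∈D in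
    subst (Edge a _) fi≡x (w⇒C i c)
  homog-on⇒homog-at from-D (inj₂ C⇒w) = inj₂ λ x x∈D → let i , fi≡x , c = from-D x x∈D in
    subst (λ y → Edge a y _) fi≡x (C⇒w i c)

  restricted-⊆ : ∀ (P : Fin n → Bool) {v} → v ∈ tabulate (λ v → lookup X v ∧ P v) → v ∈ X
  restricted-⊆ P {v} v∈ = lookup⇒[]= v X (T⇒≡ (proj₁ (T-∧⁻ (lookup X v)
    (≡⇒T (trans (sym (lookup∘tabulate _ v)) ([]=⇒lookup v∈))))))

  class-members : ∀ {D : Subset n} {C : Fin k → Bool} → (∀ {v} → v ∈ D → v ∈ X) →
    (∀ s → lookup D (f s) ≡ C s) → ∀ x → x ∈ D → ∃ λ s → f s ≡ x × T (C s)
  class-members D⊆X D-on-copy x x∈D with onto-X x (D⊆X x∈D)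
  ... | s , refl = s , refl , ≡⇒T (trans (sym (D-on-copy s)) ([]=⇒lookup x∈D))

  outdeg-copy : ∀ s → outdegIn a X (f s) ≡ count k (S s)
  outdeg-copy s = begin
    ∣ X ∩ outNbhd a (f s) ∣                        ≡⟨ ∣p∣≡count (X ∩ outNbhd a (f s)) ⟩
    count n (lookup (X ∩ outNbhd a (f s)))         ≡⟨ count-cong n lookup-∩ ⟩
    count n (λ w → lookup X w ∧ a (f s) w)         ≡⟨ count-image _ f f-injective out-in-image ⟩
    count k (λ t → lookup X (f t) ∧ a (f s) (f t)) ≡⟨ count-cong k (λ t → cong₂ _∧_ ([]=⇒lookup (in-X t)) (copy s t)) ⟩
    count k (S s)                                  ∎
    where
    open ≡-Reasoning
    lookup-∩ : ∀ w → lookup (X ∩ outNbhd a (f s)) w ≡ (lookup X w ∧ a (f s) w)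
    lookup-∩ w = trans (lookup-zipWith _∧_ w X _) (cong (lookup X w ∧_) (lookup∘tabulate (a (f s)) w))
    out-in-image : ∀ w → T (lookup X w ∧ a (f s) w) → ∃ λ t → f t ≡ w
    out-in-image w h = onto-X w (lookup⇒[]= w X (T⇒≡ (proj₁ (T-∧⁻ (lookup X w) h))))

  outdeg-class : ∀ d s → lookup (tabulate (λ v → lookup X v ∧ (outdegIn a X v ≡ᵇ d))) (f s) ≡ (count k (S s) ≡ᵇ d)
  outdeg-class d s =
    trans (lookup∘tabulate _ (f s)) (cong₂ (λ x e → x ∧ (e ≡ᵇ d)) ([]=⇒lookup (in-X s)) (outdeg-copy s))

induced-homogeneous-set : ∀ {n k} {a : Adj (Fin n)} → IsTournament a → Free a Δ122 →
  {S : Adj (Fin (suc k))} → T (Δ-free-extensionsᵇ S (uniformᵇ (λ _ → true))) →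
  ∀ {X} → InducedIso a X S → HomogeneousSet a X
induced-homogeneous-set {a = a} tour free chk {X} induced = (f zero , in-X zero) , homogeneous
  where
  open InducedCopy a induced
  homogeneous : ∀ w → w ∉ X → Homog-at a X w
  homogeneous w w∉X = homog-on⇒homog-at (λ x x∈X → let i , fi≡x = onto-X x x∈X in i , fi≡x , tt)
    (copy-homogeneous tour free chk copy w (outside-X w∉X))

induced-P₇⁻-homogeneous-pair : ∀ {n} {a : Adj (Fin n)} → IsTournament a → Free a Δ122 →
  ∀ {X} → InducedIso a X P₇⁻ → HomogeneousPair a (D₁ a X) (D₂ a X)
induced-P₇⁻-homogeneous-pair {n} {a} tour free {X} induced =
  disjoint , (f 0F , D₁-member 0F refl) , (f 2F , D₂-member 2F refl) ,
  (λ w w∉D₁ w∉D₂ → homog-on⇒homog-at from-D₁ (proj₁ (classes (outside-D w∉D₁ w∉D₂)))) ,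
  (λ w w∉D₂ w∉D₁ → homog-on⇒homog-at from-D₂ (proj₂ (classes (outside-D w∉D₁ w∉D₂))))
  where
  open InducedCopy a induced

  D₁-on-copy : ∀ s → lookup (D₁ a X) (f s) ≡ inD₁P₇⁻ s
  D₁-on-copy s = trans (outdeg-class 3 s) (P₇⁻-degree₃ s)

  D₂-on-copy : ∀ s → lookup (D₂ a X) (f s) ≡ not (inD₁P₇⁻ s)
  D₂-on-copy s = trans (outdeg-class 2 s) (P₇⁻-degree₂ s)

  D₁-member : ∀ s → inD₁P₇⁻ s ≡ true → f s ∈ D₁ a X
  D₁-member s c = lookup⇒[]= (f s) (D₁ a X) (trans (D₁-on-copy s) c)

  D₂-member : ∀ s → inD₁P₇⁻ s ≡ false → f s ∈ D₂ a X
  D₂-member s c = lookup⇒[]= (f s) (D₂ a X) (trans (D₂-on-copy s) (cong not c))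

  from-D₁ : ∀ x → x ∈ D₁ a X → ∃ λ s → f s ≡ x × T (inD₁P₇⁻ s)
  from-D₁ = class-members (restricted-⊆ _) D₁-on-copy

  from-D₂ : ∀ x → x ∈ D₂ a X → ∃ λ s → f s ≡ x × T (not (inD₁P₇⁻ s))
  from-D₂ = class-members (restricted-⊆ _) D₂-on-copy

  disjoint : ∀ v → v ∈ D₁ a X → v ∉ D₂ a X
  disjoint v v∈D₁ v∈D₂ with from-D₁ v v∈D₁ | from-D₂ v v∈D₂
  ... | s , refl , c | t , ft≡fs , c′ with refl ← f-injective ft≡fs = subst (T ∘ not) (T⇒≡ c) c′

  outside-D : ∀ {w} → w ∉ D₁ a X → w ∉ D₂ a X → w ∉ X
  outside-D w∉D₁ w∉D₂ w∈X with onto-X _ w∈X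
  ... | s , refl with inD₁P₇⁻ s in c
  ...   | true  = w∉D₁ (D₁-member s c)
  ...   | false = w∉D₂ (D₂-member s c)

  classes : ∀ {w} → w ∉ X → Homog-on a f inD₁P₇⁻ w × Homog-on a f (not ∘ inD₁P₇⁻) w
  classes w∉X = P₇⁻-copy-classes tour free copy _ (outside-X w∉X)

-- Blow-ups: substitutions and P₇⁻-joins

-- Checks `goal` on every 5-tuple of elements of `elems` whose entries pairwise `fit`,
-- discarding a tuple as soon as one of its prefixes does not fit.
module PrunedSearch {A : Set} (elems : List A) (fit : Fin 5 → Fin 5 → A → A → Bool)
  (goal : Vec A 5 → Bool) where

  private
    fitᵖ : Fin 5 → Fin 5 → A → A → Bool
    fitᵖ i j x y = fit i j x y ∧ fit j i y x

    all-sound : ∀ (P : A → Bool) → T (all P elems) → ∀ {x} → x ∈ˡ elems → T (P x)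
    all-sound P h x∈ = All.lookup (all⁺ P elems h) x∈

  opaque
    search : Bool
    search =
      all (λ k₀ →
      all (λ k₁ → not (fitᵖ 0F 1F k₀ k₁) ∨
      all (λ k₂ → not (fitᵖ 0F 2F k₀ k₂ ∧ fitᵖ 1F 2F k₁ k₂) ∨
      all (λ k₃ → not (fitᵖ 0F 3F k₀ k₃ ∧ (fitᵖ 1F 3F k₁ k₃ ∧ fitᵖ 2F 3F k₂ k₃)) ∨
      all (λ k₄ → not (fitᵖ 0F 4F k₀ k₄ ∧ (fitᵖ 1F 4F k₁ k₄ ∧ (fitᵖ 2F 4F k₂ k₄ ∧ fitᵖ 3F 4F k₃ k₄))) ∨
      goal (k₀ ∷ k₁ ∷ k₂ ∷ k₃ ∷ k₄ ∷ [])) elems) elems) elems) elems) elems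

    search-sound : T search → (κ : Fin 5 → A) → (∀ i → κ i ∈ˡ elems) →
      (∀ i j → T (fit i j (κ i) (κ j))) → T (goal (tabulate κ))
    search-sound h κ κ∈ fits =
      let h₁ = all-sound _ h (κ∈ 0F)
          h₂ = modus-ponensᵇ (f 0F 1F) (p 0F 1F) (all-sound _ h₁ (κ∈ 1F))
          h₃ = modus-ponensᵇ (f 0F 2F ∧ f 1F 2F) (T-∧⁺ (f 0F 2F) (p 0F 2F) (p 1F 2F)) (all-sound _ h₂ (κ∈ 2F))
          h₄ = modus-ponensᵇ (f 0F 3F ∧ (f 1F 3F ∧ f 2F 3F))
                 (T-∧⁺ (f 0F 3F) (p 0F 3F) (T-∧⁺ (f 1F 3F) (p 1F 3F) (p 2F 3F))) (all-sound _ h₃ (κ∈ 3F))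
      in modus-ponensᵇ (f 0F 4F ∧ (f 1F 4F ∧ (f 2F 4F ∧ f 3F 4F)))
           (T-∧⁺ (f 0F 4F) (p 0F 4F) (T-∧⁺ (f 1F 4F) (p 1F 4F) (T-∧⁺ (f 2F 4F) (p 2F 4F) (p 3F 4F))))
           (all-sound _ h₄ (κ∈ 4F))
      where
      f : Fin 5 → Fin 5 → Bool
      f i j = fitᵖ i j (κ i) (κ j)
      p : ∀ i j → T (f i j)
      p i j = T-∧⁺ (fit i j (κ i) (κ j)) (fits i j) (fits j i)

-- A tournament obtained from T by replacing the r "hub" vertices by S, where the vertex s of S
-- takes over the edges of the hub π s.  A vertex is described by its shape: a vertex of S, or an
-- old vertex together with the directions of its edges to the hubs.
module BlowUp {k r : ℕ} (S : Adj (Fin k)) (π : Fin k → Fin r) (hubs : Adj (Fin r))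
  (olds : List (Vec Bool r)) where

  Shape : Set
  Shape = Fin k ⊎ Vec Bool r

  shapes : List Shape
  shapes = map inj₁ (allFin k) ++ map inj₂ olds

  new∈shapes : ∀ s → inj₁ s ∈ˡ shapes
  new∈shapes s = ∈-++⁺ˡ (∈-map⁺ inj₁ (∈-allFin s))

  old∈shapes : ∀ {p} → p ∈ˡ olds → inj₂ p ∈ˡ shapes
  old∈shapes p∈ = ∈-++⁺ʳ _ (∈-map⁺ inj₂ p∈)

  expected : Shape → Shape → Bool → Bool
  expected (inj₁ s) (inj₁ t) _ = S s t
  expected (inj₁ s) (inj₂ p) _ = not (lookup p (π s))
  expected (inj₂ p) (inj₁ t) _ = lookup p (π t)
  expected (inj₂ _) (inj₂ _) e = e

  fit : Fin 5 → Fin 5 → Shape → Shape → Bool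
  fit i j (inj₁ s) (inj₁ t) = ⌊ S s t ≟ᵇ Δ122 i j ⌋
  fit i j (inj₁ s) (inj₂ p) = ⌊ not (lookup p (π s)) ≟ᵇ Δ122 i j ⌋
  fit i j (inj₂ p) (inj₁ t) = ⌊ lookup p (π t) ≟ᵇ Δ122 i j ⌋
  fit i j (inj₂ _) (inj₂ _) = true

  fit-expected : ∀ i j σ σ′ e → expected σ σ′ e ≡ Δ122 i j → T (fit i j σ σ′)
  fit-expected i j (inj₁ s) (inj₁ t) e eq = fromWitness eq
  fit-expected i j (inj₁ s) (inj₂ p) e eq = fromWitness eq
  fit-expected i j (inj₂ p) (inj₁ t) e eq = fromWitness eq
  fit-expected i j (inj₂ _) (inj₂ _) e eq = tt

  isOld : Shape → Bool
  isOld (inj₁ _) = false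
  isOld (inj₂ _) = true

  from-hub : Fin r → Shape → Bool
  from-hub ρ (inj₁ _) = false
  from-hub ρ (inj₂ p) = not (lookup p ρ)

  to-hub : Shape → Fin r → Bool
  to-hub (inj₁ _) ρ = false
  to-hub (inj₂ p) ρ = lookup p ρ

  between-olds : Shape → Shape → Bool → Bool
  between-olds (inj₂ _) (inj₂ _) e = e
  between-olds (inj₁ _) _        _ = false
  between-olds (inj₂ _) (inj₁ _) _ = false

  -- The hubs together with five vertices of the given shapes, keeping only the edges that are
  -- edges of T between hubs and old vertices.
  trace′ : Vec Shape 5 → Fin r ⊎ Fin 5 → Fin r ⊎ Fin 5 → Bool
  trace′ σs (inj₁ ρ) (inj₁ ρ′) = hubs ρ ρ′
  trace′ σs (inj₁ ρ) (inj₂ j)  = from-hub ρ (lookup σs j)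
  trace′ σs (inj₂ i) (inj₁ ρ)  = to-hub (lookup σs i) ρ
  trace′ σs (inj₂ i) (inj₂ j)  = between-olds (lookup σs i) (lookup σs j) (Δ122 i j)

  trace : Vec Shape 5 → Adj (Fin (r + 5))
  trace σs p q = trace′ σs (splitAt r p) (splitAt r q)

  old-position′ : Vec Shape 5 → Fin r ⊎ Fin 5 → Bool
  old-position′ σs (inj₁ _) = false
  old-position′ σs (inj₂ i) = isOld (lookup σs i)

  old-position : Vec Shape 5 → Fin (r + 5) → Bool
  old-position σs p = old-position′ σs (splitAt r p)

  open PrunedSearch shapes fit
    (λ σs → hasΔᵇ (r + 5) (trace σs) ∨ anyᵇ r (λ ρ → twoTrianglesᵇ (r + 5) (old-position σs) (trace σs) (ρ ↑ˡ 5)))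
    public

module BlowUpCopy {n : ℕ} (a : Adj (Fin n)) (tour : IsTournament a)
  {k r : ℕ} {S : Adj (Fin k)} {π : Fin k → Fin r} {hubs : Adj (Fin r)} {olds : List (Vec Bool r)}
  (R : Fin r → Fin n) (R-hom : Homomorphism hubs a R)
  {Z : Set} (B : Adj Z) (shape : Z → BlowUp.Shape S π hubs olds) (vertex : Z → Fin n)
  (listed : ∀ z → shape z ∈ˡ BlowUp.shapes S π hubs olds)
  (edges : ∀ z z′ → B z z′ ≡ BlowUp.expected S π hubs olds (shape z) (shape z′) (a (vertex z) (vertex z′)))
  (old-vertex : ∀ z p → shape z ≡ inj₂ p → ∀ ρ → vertex z ≢ R ρ × lookup p ρ ≡ a (vertex z) (R ρ))
  where
  open Tournament a tour
  open BlowUp S π hubs olds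

  Old : Fin n → Set
  Old x = ∀ ρ → x ≢ R ρ

  private
    from-hub-edge : ∀ ρ z → from-hub ρ (shape z) ≡ true → Edge a (R ρ) (vertex z)
    from-hub-edge ρ z h with shape z in eq
    ... | inj₂ p = ¬edge⇒reverse (proj₁ (old-vertex z p eq ρ))
                     (trans (sym (proj₂ (old-vertex z p eq ρ))) (T-not⇒≡ (≡⇒T h)))

    to-hub-edge : ∀ ρ z → to-hub (shape z) ρ ≡ true → Edge a (vertex z) (R ρ)
    to-hub-edge ρ z h with shape z in eq
    ... | inj₂ p = trans (sym (proj₂ (old-vertex z p eq ρ))) h

    between-edge : ∀ z z′ {e} → B z z′ ≡ e → between-olds (shape z) (shape z′) e ≡ true →
      Edge a (vertex z) (vertex z′)
    between-edge z z′ Bzz′≡e h with shape z | shape z′ | edges z z′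
    between-edge z z′ Bzz′≡e h  | inj₂ _ | inj₂ _ | eq = trans (sym eq) (trans Bzz′≡e h)
    between-edge z z′ Bzz′≡e () | inj₁ _ | _      | _
    between-edge z z′ Bzz′≡e () | inj₂ _ | inj₁ _ | _

  module _ (e : Fin 5 → Z) (emb : ∀ i j → B (e i) (e j) ≡ Δ122 i j) where

    private
      κ : Fin 5 → Shape
      κ i = shape (e i)

      σs : Vec Shape 5
      σs = tabulate κ

      H′ : Fin r ⊎ Fin 5 → Fin n
      H′ (inj₁ ρ) = R ρ
      H′ (inj₂ i) = vertex (e i)

      H : Fin (r + 5) → Fin n
      H p = H′ (splitAt r p)

      H-hom′ : ∀ c d → trace′ σs c d ≡ true → Edge a (H′ c) (H′ d)
      H-hom′ (inj₁ ρ) (inj₁ ρ′) h = R-hom ρ ρ′ h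
      H-hom′ (inj₁ ρ) (inj₂ j)  h = from-hub-edge ρ (e j) (subst (λ σ → from-hub ρ σ ≡ true) (lookup∘tabulate κ j) h)
      H-hom′ (inj₂ i) (inj₁ ρ)  h = to-hub-edge ρ (e i) (subst (λ σ → to-hub σ ρ ≡ true) (lookup∘tabulate κ i) h)
      H-hom′ (inj₂ i) (inj₂ j)  h = between-edge (e i) (e j) (emb i j)
        (subst₂ (λ σ σ′ → between-olds σ σ′ (Δ122 i j) ≡ true) (lookup∘tabulate κ i) (lookup∘tabulate κ j) h)

      H-hom : Homomorphism (trace σs) a H
      H-hom p q = H-hom′ (splitAt r p) (splitAt r q)

      H-old : ∀ p → T (old-position σs p) → Old (H p)
      H-old p h with splitAt r p
      ... | inj₂ i with shape (e i) in eq | subst (λ σ → T (isOld σ)) (lookup∘tabulate κ i) h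
      ...   | inj₂ q | _ = λ ρ → proj₁ (old-vertex (e i) q eq ρ)

    blown-up-Δ : T search → Contains a Δ122 ⊎ Σ (Fin r) λ ρ → Σ (Fin n) λ x → Σ (Fin n) λ y₁ → Σ (Fin n) λ y₂ →
      (Old x × Old y₁ × Old y₂) × TwoTriangles a (R ρ) x y₁ y₂
    blown-up-Δ chk with T-∨⁻ (hasΔᵇ (r + 5) (trace σs)) (search-sound chk κ (λ i → listed (e i)) fits)
      where
      fits : ∀ i j → T (fit i j (κ i) (κ j))
      fits i j = fit-expected i j (κ i) (κ j) _ (trans (sym (edges (e i) (e j))) (emb i j))
    ... | inj₁ Δ = inj₁ (hasΔᵇ-transfer H-hom Δ)
    ... | inj₂ h with ρ , h ← anyᵇ-sound r h
      with x , y₁ , y₂ , (cx , cy₁ , cy₂) , two ← twoTrianglesᵇ-transfer H-hom (ρ ↑ˡ 5) h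
      = inj₂ (ρ , H x , H y₁ , H y₂ , (H-old x cx , H-old y₁ cy₁ , H-old y₂ cy₂)
             , subst (λ h → TwoTriangles a h (H x) (H y₁) (H y₂)) (cong H′ (splitAt-↑ˡ r ρ 5)) two)

substitution-tournament : ∀ {n k} {a : Adj (Fin n)} {S : Adj (Fin k)} → IsTournament a → IsTournament S →
  ∀ v → IsTournament (Subst a v S)
substitution-tournament {a = a} {S} tour Stour v = loopless , antisymmetric
  where
  open Tournament a tour
  loopless : ∀ z → Subst a v S z z ≡ false
  loopless (inj₁ (x , _)) = irreflexive x
  loopless (inj₂ s)       = proj₁ Stour s
  antisymmetric : ∀ z z′ → z ≢ z′ → Subst a v S z′ z ≡ not (Subst a v S z z′)
  antisymmetric (inj₁ (x , _))  (inj₁ (y , _))  z≢z′ = reverse (λ x≡y → z≢z′ (cong inj₁ (Σ-T-≡ x≡y)))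
  antisymmetric (inj₁ (x , x≠v)) (inj₂ t)       _    = reverse (toWitnessFalse x≠v)
  antisymmetric (inj₂ s)       (inj₁ (y , y≠v)) _    =
    trans (sym (not-involutive _)) (cong not (sym (reverse (toWitnessFalse y≠v))))
  antisymmetric (inj₂ s)       (inj₂ t)        z≢z′ = proj₂ Stour s t (λ s≡t → z≢z′ (cong inj₂ s≡t))

-- A single hub v; an old vertex x has shape [xv].
module SubstitutionBlowUp {k : ℕ} (S : Adj (Fin k)) =
  BlowUp S (λ _ → zero) (λ _ _ → false) ((true ∷ []) ∷ (false ∷ []) ∷ [])

substitution-check : ∀ {k} → Adj (Fin k) → Bool
substitution-check S = SubstitutionBlowUp.search S

substitution-Δ-free : ∀ {n} {a : Adj (Fin n)} → IsTournament a → Free a Δ122 → ∀ {v} → Nice a v →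
  ∀ {k} {S : Adj (Fin k)} → T (substitution-check S) → Free (Subst a v S) Δ122
substitution-Δ-free {n} {a} tour free {v} nice {k} {S} chk (e , _ , emb)
  with blown-up-Δ e emb chk
  where
  open Tournament a tour
  open SubstitutionBlowUp S
  shape : Rest n v ⊎ Fin k → Shape
  shape (inj₁ (x , _)) = inj₂ (a x v ∷ [])
  shape (inj₂ s)       = inj₁ s
  vertex : Rest n v ⊎ Fin k → Fin n
  vertex (inj₁ (x , _)) = x
  vertex (inj₂ _)       = v
  listed : ∀ z → shape z ∈ˡ shapes
  listed (inj₁ (x , _)) with a x v
  ... | true  = old∈shapes (here refl)
  ... | false = old∈shapes (there (here refl))
  listed (inj₂ s) = new∈shapes s
  edges : ∀ z z′ → Subst a v S z z′ ≡ expected (shape z) (shape z′) (a (vertex z) (vertex z′))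
  edges (inj₁ _)        (inj₁ _) = refl
  edges (inj₁ _)        (inj₂ _) = refl
  edges (inj₂ _) (inj₁ (y , y≠v)) = reverse (toWitnessFalse y≠v)
  edges (inj₂ _)        (inj₂ _) = refl
  old-vertex : ∀ z p → shape z ≡ inj₂ p → ∀ ρ → vertex z ≢ v × lookup p ρ ≡ a (vertex z) v
  old-vertex (inj₁ (x , x≠v)) _ refl zero = toWitnessFalse x≠v , refl
  open BlowUpCopy a tour (λ _ → v) (λ _ _ ()) (Subst a v S) shape vertex listed edges old-vertex
... | inj₁ Δ = free Δ
... | inj₂ (_ , x , y₁ , y₂ , _ , two) = nice (x , y₁ , y₂ , two)

opaque
  unfolding hasΔᵇ twoTrianglesᵇ PrunedSearch.search

  basic-substitution-check : ∀ b → T (substitution-check (badj b))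
  basic-substitution-check t5  = tt
  basic-substitution-check p7⁻ = tt
  basic-substitution-check p7  = tt

-- Bridges

-- An endpoint w, at position p of σ, of an isolated backedge ww′ whose cuts are matchings.
module Endpoint {n : ℕ} (a : Adj (Fin n)) (tour : IsTournament a) (σ : Permutation′ n)
  {p p′ w w′ : Fin n} (σp : σ ⟨$⟩ʳ p ≡ w) (σp′ : σ ⟨$⟩ʳ p′ ≡ w′)
  (isolated : ∀ q → BEdge a σ p q → q ≡ p′) (cut : CutMatching a σ p) where
  open Tournament a tour

  pos : Fin n → Fin n
  pos x = σ ⟨$⟩ˡ x

  private
    σ-pos : ∀ x → σ ⟨$⟩ʳ pos x ≡ x
    σ-pos x = inverseʳ σ

    pos-injective : ∀ {x y} → pos x ≡ pos y → x ≡ y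
    pos-injective {x} {y} eq = trans (sym (σ-pos x)) (trans (cong (σ ⟨$⟩ʳ_) eq) (σ-pos y))

    w-at : ∀ {x} → p ≡ pos x → w ≡ x
    w-at {x} eq = trans (sym σp) (trans (cong (σ ⟨$⟩ʳ_) eq) (σ-pos x))

    not-partner : ∀ {x} → x ≢ w′ → pos x ≢ p′
    not-partner x≢w′ eq = x≢w′ (trans (sym (σ-pos _)) (trans (cong (σ ⟨$⟩ʳ_) eq) σp′))

    backedge : ∀ {x y} → pos y Fin.< pos x → Edge a x y → Back a σ (pos x) (pos y)
    backedge lt e = lt , subst₂ (Edge a) (sym (σ-pos _)) (sym (σ-pos _)) e

  out-forward : ∀ {x} → x ≢ w′ → Edge a w x → p Fin.< pos x
  out-forward {x} x≢w′ wx with <-cmp p (pos x)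
  ... | tri< p<x _ _ = p<x
  ... | tri≈ _ p≡x _ = ⊥-elim (edge⇒≢ wx (w-at p≡x))
  ... | tri> _ _ x<p = ⊥-elim (not-partner x≢w′ (isolated (pos x)
          (inj₁ (x<p , subst (λ z → Edge a z (σ ⟨$⟩ʳ pos x)) (sym σp) (subst (Edge a w) (sym (σ-pos x)) wx)))))

  in-backward : ∀ {x} → x ≢ w′ → Edge a x w → pos x Fin.< p
  in-backward {x} x≢w′ xw with <-cmp p (pos x)
  ... | tri> _ _ x<p = x<p
  ... | tri≈ _ p≡x _ = ⊥-elim (edge⇒≢ xw (sym (w-at p≡x)))
  ... | tri< p<x _ _ = ⊥-elim (not-partner x≢w′ (isolated (pos x)
          (inj₂ (p<x , subst (Edge a (σ ⟨$⟩ʳ pos x)) (sym σp) (subst (λ z → Edge a z w) (sym (σ-pos x)) xw)))))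

  -- Two backedges leaving a common vertex across the cut at p would share their other end.
  nice-away-from-partner : ∀ {x y₁ y₂} → x ≢ w′ → y₁ ≢ w′ → y₂ ≢ w′ → ¬ TwoTriangles a w x y₁ y₂
  nice-away-from-partner x≢ y₁≢ y₂≢ two@(_ , _ , y₁≢y₂ , _) with two-triangles-orientation two
  ... | inj₁ (wx , xy₁ , xy₂ , y₁w , y₂w) =
    y₁≢y₂ (pos-injective (proj₂ cut _ _ _ y₁<p y₂<p p<x
      (inj₂ (backedge (<-trans y₁<p p<x) xy₁)) (inj₂ (backedge (<-trans y₂<p p<x) xy₂))))
    where
    p<x = out-forward x≢ wx
    y₁<p = in-backward y₁≢ y₁w
    y₂<p = in-backward y₂≢ y₂w
  ... | inj₂ (xw , y₁x , y₂x , wy₁ , wy₂) =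
    y₁≢y₂ (pos-injective (proj₁ cut _ _ _ x<p p<y₁ p<y₂
      (inj₂ (backedge (<-trans x<p p<y₁) y₁x)) (inj₂ (backedge (<-trans x<p p<y₂) y₂x))))
    where
    x<p = in-backward x≢ xw
    p<y₁ = out-forward y₁≢ wy₁
    p<y₂ = out-forward y₂≢ wy₂

module _ {n : ℕ} {a : Adj (Fin n)} (tour : IsTournament a) {u v : Fin n} where
  open Tournament a tour

  bridge-no-path : Bridge a u v → ∀ x → Edge a u x → Edge a x v → ⊥
  bridge-no-path (_ , σ , _ , _ , σi , σj , j<i , iso-i , iso-j , cut-i , cut-j) x ux xv =
    <-asym (<-trans (V.in-backward (λ x≡u → edge⇒≢ ux (sym x≡u)) xv) j<i) (U.out-forward (edge⇒≢ xv) ux)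
    where
    module U = Endpoint a tour σ σi σj iso-i cut-i
    module V = Endpoint a tour σ σj σi iso-j cut-j

  bridge-u-nice : Bridge a u v → ∀ {x y₁ y₂} → x ≢ v → y₁ ≢ v → y₂ ≢ v → ¬ TwoTriangles a u x y₁ y₂
  bridge-u-nice (_ , σ , _ , _ , σi , σj , _ , iso-i , _ , cut-i , _) =
    Endpoint.nice-away-from-partner a tour σ σi σj iso-i cut-i

  bridge-v-nice : Bridge a u v → ∀ {x y₁ y₂} → x ≢ u → y₁ ≢ u → y₂ ≢ u → ¬ TwoTriangles a v x y₁ y₂
  bridge-v-nice (_ , σ , _ , _ , σi , σj , _ , _ , iso-j , _ , cut-j) =
    Endpoint.nice-away-from-partner a tour σ σj σi iso-j cut-j

module _ {n : ℕ} {J : Adj (Fin n)} (tour : IsTournament J) {u v : Fin n} where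
  open Tournament J tour

  private
    reverse-if : ∀ {y} c → y ≢ u → y ≢ v → (if c then J v y else J u y) ≡ not (if c then J y v else J y u)
    reverse-if true  _   y≢v = reverse y≢v
    reverse-if false y≢u _   = reverse y≢u

  join-tournament : IsTournament P₇⁻ → IsTournament (Join J u v)
  join-tournament P-tour = loopless , antisymmetric
    where
    loopless : ∀ z → Join J u v z z ≡ false
    loopless (inj₁ (x , _)) = irreflexive x
    loopless (inj₂ s)       = proj₁ P-tour s
    antisymmetric : ∀ z z′ → z ≢ z′ → Join J u v z′ z ≡ not (Join J u v z z′)
    antisymmetric (inj₁ (x , _)) (inj₁ (y , _)) z≢z′ = reverse (λ x≡y → z≢z′ (cong inj₁ (Σ-T-≡ x≡y)))
    antisymmetric (inj₁ (x , x∉)) (inj₂ t)      _    = reverse-if (inD₁P₇⁻ t) (proj₁ (rest2⇒≢ x∉)) (proj₂ (rest2⇒≢ x∉))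
    antisymmetric (inj₂ s) (inj₁ (y , y∉))      _    =
      trans (sym (not-involutive _)) (cong not (sym (reverse-if (inD₁P₇⁻ s) (proj₁ (rest2⇒≢ y∉)) (proj₂ (rest2⇒≢ y∉)))))
    antisymmetric (inj₂ s) (inj₂ t)             z≢z′ = proj₂ P-tour s t (λ s≡t → z≢z′ (cong inj₂ s≡t))

-- Hub 0F is u and hub 1F is v; an old vertex x has shape [xu, xv].
join-hubs : Adj (Fin 2)
join-hubs 0F 1F = true
join-hubs _  _  = false

join-imitates : Fin 6 → Fin 2
join-imitates s = if inD₁P₇⁻ s then 1F else 0F

-- [false, true] is missing: across a bridge uv there is no path u → x → v.
join-olds : List (Vec Bool 2)
join-olds = (true ∷ true ∷ []) ∷ (true ∷ false ∷ []) ∷ (false ∷ false ∷ []) ∷ []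

module JoinBlowUp = BlowUp P₇⁻ join-imitates join-hubs join-olds

join-check : Bool
join-check = JoinBlowUp.search

join-Δ-free : ∀ {n} {J : Adj (Fin n)} → IsTournament J → Free J Δ122 → ∀ {u v} → Bridge J u v →
  T join-check → Free (Join J u v) Δ122
join-Δ-free {n} {J} tour free {u} {v} bridge chk (e , _ , emb) with blown-up-Δ e emb chk
  where
  open Tournament J tour
  open JoinBlowUp
  hub : Fin 2 → Fin n
  hub 0F = u
  hub 1F = v
  hub-hom : Homomorphism join-hubs J hub
  hub-hom 0F 1F _ = proj₁ bridge
  shape : Rest2 n u v ⊎ Fin 6 → Shape
  shape (inj₁ (x , _)) = inj₂ (J x u ∷ J x v ∷ [])
  shape (inj₂ s)       = inj₁ s
  vertex : Rest2 n u v ⊎ Fin 6 → Fin n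
  vertex (inj₁ (x , _)) = x
  vertex (inj₂ s)       = hub (join-imitates s)
  listed : ∀ z → shape z ∈ˡ shapes
  listed (inj₁ (x , x∉)) with J x u in xu | J x v in xv
  ... | true  | true  = old∈shapes (here refl)
  ... | true  | false = old∈shapes (there (here refl))
  ... | false | false = old∈shapes (there (there (here refl)))
  ... | false | true  = ⊥-elim (bridge-no-path tour bridge x (¬edge⇒reverse (proj₁ (rest2⇒≢ x∉)) xu) xv)
  listed (inj₂ s) = new∈shapes s
  edges : ∀ z z′ → Join J u v z z′ ≡ expected (shape z) (shape z′) (J (vertex z) (vertex z′))
  edges (inj₁ _) (inj₁ _) = refl
  edges (inj₁ _) (inj₂ t) with inD₁P₇⁻ t
  ... | true  = refl
  ... | false = refl
  edges (inj₂ s) (inj₁ (y , y∉)) with inD₁P₇⁻ s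
  ... | true  = reverse (proj₂ (rest2⇒≢ y∉))
  ... | false = reverse (proj₁ (rest2⇒≢ y∉))
  edges (inj₂ _) (inj₂ _) = refl
  old-vertex : ∀ z p → shape z ≡ inj₂ p → ∀ ρ → vertex z ≢ hub ρ × lookup p ρ ≡ J (vertex z) (hub ρ)
  old-vertex (inj₁ (x , x∉)) _ refl 0F = proj₁ (rest2⇒≢ x∉) , refl
  old-vertex (inj₁ (x , x∉)) _ refl 1F = proj₂ (rest2⇒≢ x∉) , refl
  open BlowUpCopy J tour hub hub-hom (Join J u v) shape vertex listed edges old-vertex
... | inj₁ Δ = free Δ
... | inj₂ (0F , x , y₁ , y₂ , (x∉ , y₁∉ , y₂∉) , two) = bridge-u-nice tour bridge (x∉ 1F) (y₁∉ 1F) (y₂∉ 1F) two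
... | inj₂ (1F , x , y₁ , y₂ , (x∉ , y₁∉ , y₂∉) , two) = bridge-v-nice tour bridge (x∉ 0F) (y₁∉ 0F) (y₂∉ 0F) two

opaque
  unfolding hasΔᵇ twoTrianglesᵇ PrunedSearch.search

  join-check-passes : T join-check
  join-check-passes = tt

module Image {n k : ℕ} (f : Fin k → Fin n) where

  outsider : Fin n → Bool
  outsider w = not (anyᵇ k (λ t → ⌊ f t ≟ w ⌋))

  outsider-≢ : ∀ {w} → T (outsider w) → ∀ t → w ≢ f t
  outsider-≢ {w} h t refl = subst (λ b → T (not b)) (T⇒≡ (anyᵇ-complete k t (fromWitness refl))) h

  image-or-outsider : ∀ w → (∃ λ t → f t ≡ w) ⊎ T (outsider w)
  image-or-outsider w with anyᵇ k (λ t → ⌊ f t ≟ w ⌋) in eq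
  ... | true  = let t , h = anyᵇ-sound k (≡⇒T eq) in inj₁ (t , toWitness h)
  ... | false = inj₂ tt

  outside⇒outsider : ∀ {w} → (∀ t → w ≢ f t) → T (outsider w)
  outside⇒outsider {w} outside with image-or-outsider w
  ... | inj₁ (t , ft≡w) = ⊥-elim (outside t (sym ft≡w))
  ... | inj₂ out = out

induced : ∀ {m n} → Adj (Fin n) → (Fin m → Fin n) → Adj (Fin m)
induced a H x y = a (H x) (H y)

induced-tournament : ∀ {m n} {a : Adj (Fin n)} {H : Fin m → Fin n} → IsTournament a →
  Injective _≡_ _≡_ H → IsTournament (induced a H)
induced-tournament {H = H} tour H-injective =
  (λ x → proj₁ tour (H x)) , (λ x y x≢y → proj₂ tour (H x) (H y) (λ e → x≢y (H-injective e)))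

induced-free : ∀ {m n k} {a : Adj (Fin n)} {H : Fin m → Fin n} {S : Adj (Fin k)} →
  Injective _≡_ _≡_ H → Free a S → Free (induced a H) S
induced-free {H = H} H-injective free (g , g-injective , g-copy) =
  free ((λ i → H (g i)) , (λ e → g-injective (H-injective e)) , g-copy)

injective-missing⇒< : ∀ {m n} {H : Fin m → Fin n} → Injective _≡_ _≡_ H → ∀ x → (∀ p → H p ≢ x) → m < n
injective-missing⇒< {m} {n} {H} H-injective x missed = injective⇒≤ {f = x ◂ H} G-injective
  where
  G-injective : Injective _≡_ _≡_ (x ◂ H)
  G-injective {zero}  {zero}  _ = refl
  G-injective {zero}  {suc q} e = ⊥-elim (missed q (sym e))
  G-injective {suc p} {zero}  e = ⊥-elim (missed p e)
  G-injective {suc p} {suc q} e = cong suc (H-injective e)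

module Contraction {n : ℕ} (a : Adj (Fin n)) (tour : IsTournament a) (free : Free a Δ122)
  {k : ℕ} {S : Adj (Fin (suc (suc k)))} {f : Fin (suc (suc k)) → Fin n}
  (f-injective : Injective _≡_ _≡_ f) (copy : IsCopy a S f)
  (homogeneous : ∀ w → (∀ i → w ≢ f i) → Homog-on a f (λ _ → true) w)
  (S01 : Edge S 0F 1F) where
  open Tournament a tour
  open Image f
  open HomogeneousCopy a tour (λ _ → true) {c = 0F} tt homogeneous

  g : Fin (count n outsider) → Fin n
  g = enumerate n outsider

  g-outside : ∀ i t → g i ≢ f t
  g-outside i = outsider-≢ (enumerate-member n outsider i)

  m : ℕ
  m = suc (count n outsider)

  H : Fin m → Fin n
  H = f 0F ◂ g

  H-injective : Injective _≡_ _≡_ H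
  H-injective {zero}  {zero}  _ = refl
  H-injective {zero}  {suc j} e = ⊥-elim (g-outside j 0F (sym e))
  H-injective {suc i} {zero}  e = ⊥-elim (g-outside i 0F e)
  H-injective {suc i} {suc j} e = cong suc (enumerate-injective n outsider e)

  H-outside : ∀ {p} → zero ≢ p → ∀ t → H p ≢ f t
  H-outside {zero}  0≢0 = ⊥-elim (0≢0 refl)
  H-outside {suc i} _   = g-outside i

  contracted : Adj (Fin m)
  contracted = induced a H

  contracted-tournament : IsTournament contracted
  contracted-tournament = induced-tournament tour H-injective

  contracted-free : Free contracted Δ122
  contracted-free = induced-free {a = a} {H = H} H-injective free

  m<n : m < n
  m<n = injective-missing⇒< H-injective (f 1F) missed
    where
    missed : ∀ p → H p ≢ f 1F
    missed zero    e with f-injective e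
    ... | ()
    missed (suc i) e = g-outside i 1F e

  module Contracted = Tournament contracted contracted-tournament

  f0≢f1 : f 0F ≢ f 1F
  f0≢f1 = edge⇒≢ (trans (copy 0F 1F) S01)

  private
    outside-triangle : ∀ {x y} → CyclicTriangle contracted zero x y → (∀ t → H x ≢ f t) × (∀ t → H y ≢ f t)
    outside-triangle {x} {y} t =
      H-outside {x} (proj₁ (Contracted.cyclic⇒≢ {zero} {x} {y} t)) ,
      H-outside {y} (proj₁ (proj₂ (Contracted.cyclic⇒≢ {zero} {x} {y} t)))

  -- Homogeneity turns two triangles at f 0F into a copy of Δ(1,2,2) through f 0F and f 1F.
  contracted-nice : Nice contracted zero
  contracted-nice (x , y₁ , y₂ , two@(_ , _ , y₁≢y₂ , t₁ , t₂))
    with outside-triangle {x} {y₁} t₁ | outside-triangle {x} {y₂} t₂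
       | Contracted.two-triangles-orientation {zero} {x} {y₁} {y₂} two
  ... | x∉ , y₁∉ | _ , y₂∉ | inj₁ (wx , xy₁ , xy₂ , y₁w , y₂w) =
    free (Δ-copy-any-orientation (y₁≢y₂ ∘ H-injective) f0≢f1 xy₁ xy₂
      (into-class y₁∉ y₁w 0F tt) (into-class y₁∉ y₁w 1F tt) (into-class y₂∉ y₂w 0F tt) (into-class y₂∉ y₂w 1F tt)
      (from-class x∉ wx 0F tt) (from-class x∉ wx 1F tt))
  ... | x∉ , y₁∉ | _ , y₂∉ | inj₂ (xw , y₁x , y₂x , wy₁ , wy₂) =
    free (Δ-copy-any-orientation f0≢f1 (y₁≢y₂ ∘ H-injective) (into-class x∉ xw 0F tt) (into-class x∉ xw 1F tt)
      (from-class y₁∉ wy₁ 0F tt) (from-class y₂∉ wy₂ 0F tt) (from-class y₁∉ wy₁ 1F tt) (from-class y₂∉ wy₂ 1F tt)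
      y₁x y₂x)

  private
    to : Rest m zero ⊎ Fin (suc (suc k)) → Fin n
    to (inj₁ (zero , ()))
    to (inj₁ (suc i , _)) = g i
    to (inj₂ s)           = f s

    to-injective : Injective _≡_ _≡_ to
    to-injective {inj₁ (zero , ())}
    to-injective {inj₁ (suc i , _)} {inj₁ (zero , ())}
    to-injective {inj₁ (suc i , _)} {inj₁ (suc j , _)} e = cong inj₁ (Σ-T-≡ (cong suc (enumerate-injective n outsider e)))
    to-injective {inj₁ (suc i , _)} {inj₂ t}           e = ⊥-elim (g-outside i t e)
    to-injective {inj₂ s}           {inj₁ (zero , ())}
    to-injective {inj₂ s}           {inj₁ (suc j , _)} e = ⊥-elim (g-outside j s (sym e))
    to-injective {inj₂ s}           {inj₂ t}           e = cong inj₂ (f-injective e)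

    to-surjective : ∀ w → ∃ λ z → ∀ {z′} → z′ ≡ z → to z′ ≡ w
    to-surjective w with image-or-outsider w
    ... | inj₁ (t , ft≡w) = inj₂ t , λ { refl → ft≡w }
    ... | inj₂ out with i , gi≡w ← enumerate-surjective n outsider w out = inj₁ (suc i , tt) , λ { refl → gi≡w }

    to-edges : ∀ z z′ → a (to z) (to z′) ≡ Subst contracted zero S z z′
    to-edges (inj₁ (zero , ()))    _
    to-edges (inj₁ (suc i , _))    (inj₁ (zero , ()))
    to-edges (inj₁ (suc i , _))    (inj₁ (suc j , _)) = refl
    to-edges (inj₁ (suc i , _))    (inj₂ t)           = to-class (g-outside i) t tt
    to-edges (inj₂ s)              (inj₁ (zero , ()))
    to-edges (inj₂ s)              (inj₁ (suc j , _)) = of-class (g-outside j) s tt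
    to-edges (inj₂ s)              (inj₂ t)           = copy s t

  contracted-iso : Iso (Subst contracted zero S) a
  contracted-iso = mk⤖ (to-injective , to-surjective) , to-edges

-- Undoing a P₇⁻-join: the copy f of P₇⁻ shrinks to u = f 5F ∈ D₂ and v = f 0F ∈ D₁.  The vertices
-- are ordered by blockOf: first those dominating u and v, then v, then those x with v → x → u, then
-- u, then those dominated by u and v (no x has u → x → v).  In this order uv is a bridge.
module UnJoin {n : ℕ} (a : Adj (Fin n)) (tour : IsTournament a) (free : Free a Δ122)
  {f : Fin 6 → Fin n} (f-injective : Injective _≡_ _≡_ f) (copy : IsCopy a P₇⁻ f)
  (classes : ∀ w → (∀ i → w ≢ f i) → Homog-on a f inD₁P₇⁻ w × Homog-on a f (not ∘ inD₁P₇⁻) w)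
  (no-extension : ∀ w → (∀ i → w ≢ f i) → Edge a (f 5F) w → Edge a w (f 0F) → ⊥) where
  open Tournament a tour
  open Image f
  module D₁ = HomogeneousCopy a tour inD₁P₇⁻ {c = 0F} tt (λ w w∉ → proj₁ (classes w w∉))
  module D₂ = HomogeneousCopy a tour (not ∘ inD₁P₇⁻) {c = 5F} tt (λ w w∉ → proj₂ (classes w w∉))

  u v : Fin n
  u = f 5F
  v = f 0F

  Outside : Fin n → Set
  Outside w = ∀ i → w ≢ f i

  blockOf : Fin n → Fin 5
  blockOf w with w ≟ v | w ≟ u | a w u | a w v
  ... | yes _ | _     | _     | _     = 1F
  ... | no _  | yes _ | _     | _     = 3F
  ... | no _  | no _  | true  | true  = 0F
  ... | no _  | no _  | true  | false = 2F
  ... | no _  | no _  | false | _     = 4F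

  valid : Fin n → Bool
  valid w = outsider w ∨ (⌊ w ≟ u ⌋ ∨ ⌊ w ≟ v ⌋)

  data Block (w : Fin n) : Fin 5 → Set where
    dominating : Outside w → Edge a w u → Edge a w v → Block w 0F
    is-v       : w ≡ v → Block w 1F
    cyclic     : Outside w → Edge a w u → Edge a v w → Block w 2F
    is-u       : w ≡ u → Block w 3F
    dominated  : Outside w → Edge a u w → Edge a v w → Block w 4F

  private
    outside-of : ∀ {w} → T (outsider w ∨ false) → Outside w
    outside-of h = outsider-≢ (subst T (∨-identityʳ _) h)

  block : ∀ w → T (valid w) → Block w (blockOf w)
  block w h with w ≟ v | w ≟ u | a w u in wu | a w v in wv
  ... | yes w≡v | _       | _     | _     = is-v w≡v
  ... | no _    | yes w≡u | _     | _     = is-u w≡u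
  ... | no w≢v  | no w≢u  | true  | true  = dominating (outside-of h) wu wv
  ... | no w≢v  | no w≢u  | true  | false = cyclic (outside-of h) wu (¬edge⇒reverse w≢v wv)
  ... | no w≢v  | no w≢u  | false | false = dominated (outside-of h) (¬edge⇒reverse w≢u wu) (¬edge⇒reverse w≢v wv)
  ... | no w≢v  | no w≢u  | false | true  = ⊥-elim (no-extension w (outside-of h) (¬edge⇒reverse w≢u wu) wv)

  -- opaque: otherwise the type checker unfolds remQuot inside `placed`, and the terms blow up
  opaque
    decode : Fin (5 * n) → Fin 5 × Fin n
    decode = remQuot n

    decode-combine : ∀ b w → decode (combine b w) ≡ (b , w)
    decode-combine = remQuot-combine

    combine-decode : ∀ c → combine (proj₁ (decode c)) (proj₂ (decode c)) ≡ c
    combine-decode = combine-remQuot n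

  placed : Fin 5 × Fin n → Bool
  placed bw = valid (proj₂ bw) ∧ ⌊ blockOf (proj₂ bw) ≟ proj₁ bw ⌋

  -- The vertices of the smaller tournament, in the lexicographic order of (blockOf w , w).
  m : ℕ
  m = count (5 * n) (λ c → placed (decode c))

  private
    P : Fin m → Fin (5 * n)
    P = enumerate (5 * n) (λ c → placed (decode c))

  H : Fin m → Fin n
  H p = proj₂ (decode (P p))

  private
    P-encoding : ∀ p → T (valid (H p)) × P p ≡ combine (blockOf (H p)) (H p)
    P-encoding p =
      proj₁ (T-∧⁻ (valid (H p)) h) ,
      trans (sym (combine-decode (P p))) (cong (λ b → combine b (H p)) (sym (toWitness (proj₂ (T-∧⁻ (valid (H p)) h)))))
      where h = enumerate-member (5 * n) (λ c → placed (decode c)) p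

  H-valid : ∀ p → T (valid (H p))
  H-valid p = proj₁ (P-encoding p)

  H-injective : Injective _≡_ _≡_ H
  H-injective {p} {q} e = enumerate-injective _ _
    (trans (proj₂ (P-encoding p)) (trans (cong (λ w → combine (blockOf w) w) e) (sym (proj₂ (P-encoding q)))))

  H-onto : ∀ w → T (valid w) → ∃ λ p → H p ≡ w
  H-onto w h
    with p , Pp≡c ← enumerate-surjective (5 * n) (λ c → placed (decode c)) (combine (blockOf w) w)
           (subst (λ x → T (placed x)) (sym (decode-combine (blockOf w) w)) (T-∧⁺ (valid w) h (fromWitness refl)))
    = p , trans (cong (λ c → proj₂ (decode c)) Pp≡c) (cong proj₂ (decode-combine (blockOf w) w))

  blockOf-mono : ∀ {p q} → p Fin.< q → blockOf (H p) Fin.≤ blockOf (H q)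
  blockOf-mono {p} {q} p<q = ≮⇒≥ λ later → <-asym (enumerate-monotone _ _ p<q)
    (subst₂ Fin._<_ (sym (proj₂ (P-encoding q))) (sym (proj₂ (P-encoding p))) (combine-monoˡ-< (H q) (H p) later))

  block-at : ∀ p → Block (H p) (blockOf (H p))
  block-at p = block (H p) (H-valid p)

  u≢v : u ≢ v
  u≢v u≡v with f-injective u≡v
  ... | ()

  private
    valid-u : T (valid u)
    valid-u = T-∨⁺ʳ (outsider u) (T-∨⁺ˡ ⌊ u ≟ u ⌋ (fromWitness refl))

    valid-v : T (valid v)
    valid-v = T-∨⁺ʳ (outsider v) (T-∨⁺ʳ ⌊ v ≟ u ⌋ (fromWitness refl))

  pu pv : Fin m
  pu = proj₁ (H-onto u valid-u)
  pv = proj₁ (H-onto v valid-v)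

  H-pu : H pu ≡ u
  H-pu = proj₂ (H-onto u valid-u)

  H-pv : H pv ≡ v
  H-pv = proj₂ (H-onto v valid-v)

  blockOf-pu : blockOf (H pu) ≡ 3F
  blockOf-pu rewrite H-pu with u ≟ v | u ≟ u
  ... | yes u≡v | _      = ⊥-elim (u≢v u≡v)
  ... | no _    | yes _  = refl
  ... | no _    | no u≢u = ⊥-elim (u≢u refl)

  blockOf-pv : blockOf (H pv) ≡ 1F
  blockOf-pv rewrite H-pv with v ≟ v
  ... | yes _  = refl
  ... | no v≢v = ⊥-elim (v≢v refl)

  private
    below : ∀ {p q} → p Fin.< q → ∀ {r} → blockOf (H q) ≡ r → blockOf (H p) Fin.≤ r
    below p<q refl = blockOf-mono p<q

    above : ∀ {p q} → q Fin.< p → ∀ {r} → blockOf (H q) ≡ r → r Fin.≤ blockOf (H p)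
    above q<p refl = blockOf-mono q<p

    elsewhere : ∀ {p q w} → H p ≡ w → p ≢ q → H q ≢ w
    elsewhere Hp≡w p≢q Hq≡w = p≢q (H-injective (trans Hp≡w (sym Hq≡w)))

  before-u : ∀ {p} → p Fin.< pu → Edge a (H p) (f 2F) × Edge a (H p) (f 4F)
  before-u {p} p<pu with blockOf (H p) | block-at p | below p<pu blockOf-pu
  ... | 0F | dominating out pu _ | _ = D₂.into-class out pu 2F tt , D₂.into-class out pu 4F tt
  ... | 1F | is-v p≡v            | _ = subst (λ x → Edge a x (f 2F)) (sym p≡v) (copy 0F 2F)
                                     , subst (λ x → Edge a x (f 4F)) (sym p≡v) (copy 0F 4F)
  ... | 2F | cyclic out pu _     | _ = D₂.into-class out pu 2F tt , D₂.into-class out pu 4F tt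
  ... | 3F | is-u p≡u            | _ = ⊥-elim (elsewhere H-pu (<⇒≢ p<pu ∘ sym) p≡u)
  ... | 4F | _ | s≤s (s≤s (s≤s ()))

  after-u : ∀ {p} → pu Fin.< p → Edge a (f 2F) (H p) × Edge a (f 4F) (H p)
  after-u {p} pu<p with blockOf (H p) | block-at p | above pu<p blockOf-pu
  ... | 1F | _ | s≤s ()
  ... | 2F | _ | s≤s (s≤s ())
  ... | 3F | is-u p≡u         | _ = ⊥-elim (elsewhere H-pu (<⇒≢ pu<p) p≡u)
  ... | 4F | dominated out up _ | _ = D₂.from-class out up 2F tt , D₂.from-class out up 4F tt

  before-v : ∀ {p} → p Fin.< pv → Edge a (H p) v × Edge a (H p) (f 1F) × Edge a (H p) u
  before-v {p} p<pv with blockOf (H p) | block-at p | below p<pv blockOf-pv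
  ... | 0F | dominating out pu pv | _ = pv , D₁.into-class out pv 1F tt , pu
  ... | 1F | is-v p≡v             | _ = ⊥-elim (elsewhere H-pv (<⇒≢ p<pv ∘ sym) p≡v)
  ... | 2F | _ | s≤s ()
  ... | 3F | _ | s≤s ()
  ... | 4F | _ | s≤s ()

  after-v : ∀ {p} → pv Fin.< p → H p ≡ u ⊎ (Edge a v (H p) × Edge a (f 1F) (H p))
  after-v {p} pv<p with blockOf (H p) | block-at p | above pv<p blockOf-pv
  ... | 1F | is-v p≡v            | _ = ⊥-elim (elsewhere H-pv (<⇒≢ pv<p) p≡v)
  ... | 2F | cyclic out _ vp     | _ = inj₂ (vp , D₁.from-class out vp 1F tt)
  ... | 3F | is-u p≡u            | _ = inj₁ p≡u
  ... | 4F | dominated out _ vp  | _ = inj₂ (vp , D₁.from-class out vp 1F tt)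

  contracted : Adj (Fin m)
  contracted = induced a H

  private
    backward : ∀ {s t} → s Fin.< t → BEdge contracted id-permutation s t → Edge a (H t) (H s)
    backward s<t (inj₁ (t<s , _)) = ⊥-elim (<-asym s<t t<s)
    backward s<t (inj₂ (_ , ts))  = ts

    from-u : ∀ {q} → Edge a (H pu) (H q) → Edge a u (H q)
    from-u {q} = subst (λ x → Edge a x (H q)) H-pu

    to-u : ∀ {q} → Edge a (H q) (H pu) → Edge a (H q) u
    to-u {q} = subst (Edge a (H q)) H-pu

    from-v : ∀ {q} → Edge a (H pv) (H q) → Edge a v (H q)
    from-v {q} = subst (λ x → Edge a x (H q)) H-pv

    to-v : ∀ {q} → Edge a (H q) (H pv) → Edge a (H q) v
    to-v {q} = subst (Edge a (H q)) H-pv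

  isolated-u : ∀ q → BEdge contracted id-permutation pu q → q ≡ pv
  isolated-u q (inj₁ (q<pu , uq)) with blockOf (H q) | block-at q | below q<pu blockOf-pu
  ... | 0F | dominating _ qu _ | _ = ⊥-elim (edge-asym (from-u uq) qu)
  ... | 1F | is-v q≡v          | _ = H-injective (trans q≡v (sym H-pv))
  ... | 2F | cyclic _ qu _     | _ = ⊥-elim (edge-asym (from-u uq) qu)
  ... | 3F | is-u q≡u          | _ = ⊥-elim (elsewhere H-pu (<⇒≢ q<pu ∘ sym) q≡u)
  ... | 4F | _ | s≤s (s≤s (s≤s ()))
  isolated-u q (inj₂ (pu<q , qu)) with blockOf (H q) | block-at q | above pu<q blockOf-pu
  ... | 1F | _ | s≤s ()
  ... | 2F | _ | s≤s (s≤s ())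
  ... | 3F | is-u q≡u          | _ = ⊥-elim (elsewhere H-pu (<⇒≢ pu<q) q≡u)
  ... | 4F | dominated _ uq _  | _ = ⊥-elim (edge-asym uq (to-u qu))

  isolated-v : ∀ q → BEdge contracted id-permutation pv q → q ≡ pu
  isolated-v q (inj₁ (q<pv , vq)) with blockOf (H q) | block-at q | below q<pv blockOf-pv
  ... | 0F | dominating _ _ qv | _ = ⊥-elim (edge-asym (from-v vq) qv)
  ... | 1F | is-v q≡v          | _ = ⊥-elim (elsewhere H-pv (<⇒≢ q<pv ∘ sym) q≡v)
  ... | 2F | _ | s≤s ()
  ... | 3F | _ | s≤s ()
  ... | 4F | _ | s≤s ()
  isolated-v q (inj₂ (pv<q , qv)) with blockOf (H q) | block-at q | above pv<q blockOf-pv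
  ... | 1F | is-v q≡v          | _ = ⊥-elim (elsewhere H-pv (<⇒≢ pv<q) q≡v)
  ... | 2F | cyclic _ _ vq     | _ = ⊥-elim (edge-asym vq (to-v qv))
  ... | 3F | is-u q≡u          | _ = H-injective (trans q≡u (sym H-pu))
  ... | 4F | dominated _ _ vq  | _ = ⊥-elim (edge-asym vq (to-v qv))

  private
    f2≢f4 : f 2F ≢ f 4F
    f2≢f4 = edge⇒≢ (copy 2F 4F)

    v≢f1 : v ≢ f 1F
    v≢f1 = edge⇒≢ (copy 0F 1F)

    distinct : ∀ {p q} → p ≢ q → H p ≢ H q
    distinct p≢q = p≢q ∘ H-injective

    -- H t ≡ u is impossible: the vertices before v dominate u.
    after-v′ : ∀ {s t} → s Fin.< pv → pv Fin.< t → BEdge contracted id-permutation s t → Edge a v (H t) × Edge a (f 1F) (H t)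
    after-v′ s<pv pv<t st with after-v pv<t
    ... | inj₂ vt = vt
    ... | inj₁ t≡u = ⊥-elim (edge-asym (subst (λ x → Edge a x _) t≡u (backward (<-trans s<pv pv<t) st))
                                        (proj₂ (proj₂ (before-v s<pv))))

  cut-u : CutMatching contracted id-permutation pu
  cut-u = same-target , same-source
    where
    same-target : ∀ s t t′ → s Fin.< pu → pu Fin.< t → pu Fin.< t′ →
      BEdge contracted id-permutation s t → BEdge contracted id-permutation s t′ → t ≡ t′
    same-target s t t′ s<pu pu<t pu<t′ st st′ with t ≟ t′
    ... | yes t≡t′ = t≡t′
    ... | no t≢t′ = ⊥-elim (free (Δ-copy-any-orientation f2≢f4 (distinct t≢t′)
      (proj₁ (before-u s<pu)) (proj₂ (before-u s<pu)) (proj₁ (after-u pu<t)) (proj₁ (after-u pu<t′))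
      (proj₂ (after-u pu<t)) (proj₂ (after-u pu<t′))
      (backward (<-trans s<pu pu<t) st) (backward (<-trans s<pu pu<t′) st′)))
    same-source : ∀ s s′ t → s Fin.< pu → s′ Fin.< pu → pu Fin.< t →
      BEdge contracted id-permutation s t → BEdge contracted id-permutation s′ t → s ≡ s′
    same-source s s′ t s<pu s′<pu pu<t st s′t with s ≟ s′
    ... | yes s≡s′ = s≡s′
    ... | no s≢s′ = ⊥-elim (free (Δ-copy-any-orientation (distinct s≢s′) f2≢f4
      (backward (<-trans s<pu pu<t) st) (backward (<-trans s′<pu pu<t) s′t)
      (proj₁ (before-u s<pu)) (proj₂ (before-u s<pu)) (proj₁ (before-u s′<pu)) (proj₂ (before-u s′<pu))
      (proj₁ (after-u pu<t)) (proj₂ (after-u pu<t))))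

  cut-v : CutMatching contracted id-permutation pv
  cut-v = same-target , same-source
    where
    same-target : ∀ s t t′ → s Fin.< pv → pv Fin.< t → pv Fin.< t′ →
      BEdge contracted id-permutation s t → BEdge contracted id-permutation s t′ → t ≡ t′
    same-target s t t′ s<pv pv<t pv<t′ st st′ with t ≟ t′
    ... | yes t≡t′ = t≡t′
    ... | no t≢t′ = ⊥-elim (free (Δ-copy-any-orientation v≢f1 (distinct t≢t′)
      (proj₁ (before-v s<pv)) (proj₁ (proj₂ (before-v s<pv)))
      (proj₁ (after-v′ s<pv pv<t st)) (proj₁ (after-v′ s<pv pv<t′ st′))
      (proj₂ (after-v′ s<pv pv<t st)) (proj₂ (after-v′ s<pv pv<t′ st′))
      (backward (<-trans s<pv pv<t) st) (backward (<-trans s<pv pv<t′) st′)))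
    same-source : ∀ s s′ t → s Fin.< pv → s′ Fin.< pv → pv Fin.< t →
      BEdge contracted id-permutation s t → BEdge contracted id-permutation s′ t → s ≡ s′
    same-source s s′ t s<pv s′<pv pv<t st s′t with s ≟ s′
    ... | yes s≡s′ = s≡s′
    ... | no s≢s′ = ⊥-elim (free (Δ-copy-any-orientation (distinct s≢s′) v≢f1
      (backward (<-trans s<pv pv<t) st) (backward (<-trans s′<pv pv<t) s′t)
      (proj₁ (before-v s<pv)) (proj₁ (proj₂ (before-v s<pv)))
      (proj₁ (before-v s′<pv)) (proj₁ (proj₂ (before-v s′<pv)))
      (proj₁ (after-v′ s<pv pv<t st)) (proj₂ (after-v′ s<pv pv<t st))))

  pv<pu : pv Fin.< pu
  pv<pu with <-cmp pv pu
  ... | tri< pv<pu _ _ = pv<pu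
  ... | tri≈ _ pv≡pu _ = ⊥-elim (u≢v (trans (sym H-pu) (trans (cong H (sym pv≡pu)) H-pv)))
  ... | tri> _ _ pu<pv with subst₂ Fin._≤_ blockOf-pu blockOf-pv (blockOf-mono pu<pv)
  ...   | s≤s ()

  bridge : Bridge contracted pu pv
  bridge = subst₂ (Edge a) (sym H-pu) (sym H-pv) (copy 5F 0F) , id-permutation , pu , pv , refl , refl , pv<pu
         , isolated-u , isolated-v , cut-u , cut-v

  H-outside : ∀ {p} → p ≢ pu → p ≢ pv → Outside (H p)
  H-outside {p} p≢pu p≢pv with blockOf (H p) | block-at p
  ... | 0F | dominating out _ _ = out
  ... | 1F | is-v p≡v           = ⊥-elim (elsewhere H-pv (p≢pv ∘ sym) p≡v)
  ... | 2F | cyclic out _ _     = out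
  ... | 3F | is-u p≡u           = ⊥-elim (elsewhere H-pu (p≢pu ∘ sym) p≡u)
  ... | 4F | dominated out _ _  = out

  m<n : m < n
  m<n = injective-missing⇒< H-injective (f 1F) missed
    where
    missed : ∀ p → H p ≢ f 1F
    missed p Hp≡f1 with p ≟ pu | p ≟ pv
    ... | yes refl | _        with f-injective (trans (sym H-pu) Hp≡f1)
    ...   | ()
    missed p Hp≡f1 | no _ | yes refl with f-injective (trans (sym H-pv) Hp≡f1)
    ...   | ()
    missed p Hp≡f1 | no p≢pu | no p≢pv = H-outside p≢pu p≢pv 1F Hp≡f1

  contracted-tournament : IsTournament contracted
  contracted-tournament = induced-tournament tour H-injective

  contracted-free : Free contracted Δ122
  contracted-free = induced-free {a = a} {H = H} H-injective free

  private
    to : Rest2 m pu pv ⊎ Fin 6 → Fin n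
    to (inj₁ (p , _)) = H p
    to (inj₂ s)       = f s

    outside-rest : ∀ {p} → T (not ⌊ p ≟ pu ⌋ ∧ not ⌊ p ≟ pv ⌋) → Outside (H p)
    outside-rest p∉ = H-outside (proj₁ (rest2⇒≢ p∉)) (proj₂ (rest2⇒≢ p∉))

    to-injective : Injective _≡_ _≡_ to
    to-injective {inj₁ _}        {inj₁ _}        e = cong inj₁ (Σ-T-≡ (H-injective e))
    to-injective {inj₁ (_ , p∉)} {inj₂ t}        e = ⊥-elim (outside-rest p∉ t e)
    to-injective {inj₂ s}        {inj₁ (_ , q∉)} e = ⊥-elim (outside-rest q∉ s (sym e))
    to-injective {inj₂ _}        {inj₂ _}        e = cong inj₂ (f-injective e)

    outsider-rest : ∀ {p} → T (outsider (H p)) → T (not ⌊ p ≟ pu ⌋ ∧ not ⌊ p ≟ pv ⌋)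
    outsider-rest {p} out = T-∧⁺ (not ⌊ p ≟ pu ⌋)
      (fromWitnessFalse λ { refl → outsider-≢ out 5F H-pu })
      (fromWitnessFalse λ { refl → outsider-≢ out 0F H-pv })

    to-surjective : ∀ w → ∃ λ z → ∀ {z′} → z′ ≡ z → to z′ ≡ w
    to-surjective w with image-or-outsider w
    ... | inj₁ (t , ft≡w) = inj₂ t , λ { refl → ft≡w }
    ... | inj₂ out with p , refl ← H-onto w (T-∨⁺ˡ (outsider w) out)
      = inj₁ (p , outsider-rest out) , λ { refl → refl }

    to-edges : ∀ z z′ → a (to z) (to z′) ≡ Join contracted pu pv z z′
    to-edges (inj₁ _) (inj₁ _) = refl
    to-edges (inj₁ (p , p∉)) (inj₂ t) with inD₁P₇⁻ t in c
    ... | true  = trans (D₁.to-class (outside-rest p∉) t (≡⇒T c)) (cong (a (H p)) (sym H-pv))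
    ... | false = trans (D₂.to-class (outside-rest p∉) t (subst (λ b → T (not b)) (sym c) tt)) (cong (a (H p)) (sym H-pu))
    to-edges (inj₂ s) (inj₁ (q , q∉)) with inD₁P₇⁻ s in c
    ... | true  = trans (D₁.of-class (outside-rest q∉) s (≡⇒T c)) (cong (λ x → a x (H q)) (sym H-pv))
    ... | false = trans (D₂.of-class (outside-rest q∉) s (subst (λ b → T (not b)) (sym c) tt)) (cong (λ x → a x (H q)) (sym H-pu))
    to-edges (inj₂ s) (inj₂ t) = copy s t

  contracted-iso : Iso (Join contracted pu pv) a
  contracted-iso = mk⤖ (to-injective , to-surjective) , to-edges

-- P₇ is circulant: its vertex 0F can play the deleted vertex 6 of P₇⁻, whose out-neighbours form D₁.
P₇-extends-P₇⁻ : ∀ i j → extend P₇⁻ (tabulate inD₁P₇⁻) i j ≡ P₇ i j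
P₇-extends-P₇⁻ i j =
  toWitness {a? = agrees i j} (allᵇ-sound 7 {λ j → ⌊ agrees i j ⌋} (allᵇ-sound 7 {λ i → allᵇ 7 (λ j → ⌊ agrees i j ⌋)} tt i) j)
  where
  agrees : ∀ i j → Dec (extend P₇⁻ (tabulate inD₁P₇⁻) i j ≡ P₇ i j)
  agrees i j = extend P₇⁻ (tabulate inD₁P₇⁻) i j ≟ᵇ P₇ i j

Decomposition : ∀ {n} → Adj (Fin n) → Set
Decomposition {n} a = Σ ℕ λ m → Σ (Adj (Fin m)) λ a′ → m < n × IsTournament a′ × Free a′ Δ122
  × ((Σ (Fin m) λ v → Σ Basic λ b → Nice a′ v × Iso (Subst a′ v (badj b)) a)
     ⊎ (Σ (Fin m) λ u → Σ (Fin m) λ v → Bridge a′ u v × Iso (Join a′ u v) a))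

module _ {n : ℕ} {a : Adj (Fin n)} (tour : IsTournament a) (free : Free a Δ122) where
  open Tournament a tour

  T₅-decomposition : ∀ {f} → Injective _≡_ _≡_ f → IsCopy a T₅ f → Decomposition a
  T₅-decomposition f-injective copy =
    m , contracted , m<n , contracted-tournament , contracted-free , inj₁ (zero , t5 , contracted-nice , contracted-iso)
    where open Contraction a tour free f-injective copy (copy-homogeneous tour free T₅-extensions copy) refl

  P₇-decomposition : ∀ {f} → Injective _≡_ _≡_ f → IsCopy a P₇ f → Decomposition a
  P₇-decomposition f-injective copy =
    m , contracted , m<n , contracted-tournament , contracted-free , inj₁ (zero , p7 , contracted-nice , contracted-iso)
    where open Contraction a tour free f-injective copy (copy-homogeneous tour free P₇-extensions copy) refl

  P₇⁻-completion : ∀ {f w} → IsCopy a P₇⁻ f → (∀ i → w ≢ f i) → Edge a (f 5F) w → Edge a w (f 0F) →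
    IsCopy a P₇ (w ◂ f)
  P₇⁻-completion {f} {w} copy outside uw wv i j =
    trans (extension-copy tour copy outside row i j) (P₇-extends-P₇⁻ i j)
    where
    open HomogeneousCopy a tour inD₁P₇⁻ {c = 0F} tt (λ w w∉ → proj₁ (P₇⁻-copy-classes tour free copy w w∉))
      renaming (into-class to into-D₁)
    open HomogeneousCopy a tour (not ∘ inD₁P₇⁻) {c = 5F} tt (λ w w∉ → proj₂ (P₇⁻-copy-classes tour free copy w w∉))
      renaming (from-class to from-D₂)
    row : ∀ i → a w (f i) ≡ lookup (tabulate inD₁P₇⁻) i
    row i with inD₁P₇⁻ i in c | lookup∘tabulate inD₁P₇⁻ i
    ... | true  | eq = trans (into-D₁ outside wv i (≡⇒T c)) (sym eq)
    ... | false | eq = trans (edge⇒¬reverse (from-D₂ outside uw i (subst (λ b → T (not b)) (sym c) tt))) (sym eq)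

  P₇⁻-decomposition : ∀ {f} → Injective _≡_ _≡_ f → IsCopy a P₇⁻ f → Decomposition a
  P₇⁻-decomposition {f} f-injective copy with anyᵇ n (λ w → Image.outsider f w ∧ (a (f 5F) w ∧ a w (f 0F))) in eq
  ... | true
    with w , h ← anyᵇ-sound n (≡⇒T eq)
    with out , h ← T-∧⁻ (Image.outsider f w) h
    with uw , wv ← T-∧⁻ (a (f 5F) w) h
    = P₇-decomposition (copy⇒injective (basic-tournament p7) (w ◂ f) completed) completed
    where
    open Image f
    completed = P₇⁻-completion copy (outsider-≢ out) (T⇒≡ uw) (T⇒≡ wv)
  ... | false = m , contracted , m<n , contracted-tournament , contracted-free , inj₂ (pu , pv , bridge , contracted-iso)
    where
    open Image f
    no-extension : ∀ w → (∀ i → w ≢ f i) → Edge a (f 5F) w → Edge a w (f 0F) → ⊥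
    no-extension w outside uw wv = subst T eq
      (anyᵇ-complete n w (T-∧⁺ (outsider w) (outside⇒outsider outside) (T-∧⁺ (a (f 5F) w) (≡⇒T uw) (≡⇒T wv))))
    open UnJoin a tour free f-injective copy (P₇⁻-copy-classes tour free copy) no-extension

  decomposition : (Σ Basic λ b → Contains a (badj b)) → Decomposition a
  decomposition (t5  , f , f-injective , copy) = T₅-decomposition f-injective copy
  decomposition (p7⁻ , f , f-injective , copy) = P₇⁻-decomposition f-injective copy
  decomposition (p7  , f , f-injective , copy) = P₇-decomposition f-injective copy

theorem3p8 : (n : ℕ) (a : Adj (Fin n)) → IsTournament a → Free a Δ122 →
    ((X : Subset n) → (InducedIso a X T₅ ⊎ InducedIso a X P₇) → HomogeneousSet a X)
    × ((X : Subset n) → InducedIso a X P₇⁻ → HomogeneousPair a (D₁ a X) (D₂ a X))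
    × ((v : Fin n) (b : Basic) → Nice a v →
         IsTournament (Subst a v (badj b)) × Free (Subst a v (badj b)) Δ122)
    × ((u v : Fin n) → Bridge a u v →
         IsTournament (Join a u v) × Free (Join a u v) Δ122)
    × ((Σ Basic λ b → Contains a (badj b)) →
         Σ ℕ λ m → Σ (Adj (Fin m)) λ a′ → m < n × IsTournament a′ × Free a′ Δ122
           × ((Σ (Fin m) λ v → Σ Basic λ b → Nice a′ v × Iso (Subst a′ v (badj b)) a)
              ⊎ (Σ (Fin m) λ u → Σ (Fin m) λ v → Bridge a′ u v × Iso (Join a′ u v) a)))
theorem3p8 n a tour free =
    (λ X → [ induced-homogeneous-set tour free T₅-extensions , induced-homogeneous-set tour free P₇-extensions ])
  , (λ X → induced-P₇⁻-homogeneous-pair tour free)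
  , (λ v b nice → substitution-tournament tour (basic-tournament b) v
                , substitution-Δ-free tour free nice (basic-substitution-check b))
  , (λ u v bridge → join-tournament tour (basic-tournament p7⁻) , join-Δ-free tour free bridge join-check-passes)
  , decomposition tour free
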